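{- Let $T_{k,h}$ be a full $k$-ary tree of height $h$ and order $n$. Then \[\log_k((k-1)n+1)-1\le \operatorname{ept}(T_{k,h})=O((\log n)^2),\] where the constant in the upper bound depends on $k$.
   Context: The full $k$-ary tree of height $h$, $T_{k,h}$, is constructed from a root by performing $h$ steps in which $k$ leaves are appended to each vertex of degree at most one; its order is $n=\frac{k^{h+1}-1}{k-1}$. Probabilistic zero forcing on a graph $G$: vertices are colored blue or white. The process proceeds in rounds $1,2,3,\dots$. In a round, let $B$ be the set of blue vertices at the start of the round; each blue vertex $u$ fires at each of its white neighbors $w$, and each such fire succeeds independently with probability $|N[u]\cap B|/\deg u$, where $N[u]$ is the closed neighborhood of $u$. At the end of the round, every white vertex at which at least one fire succeeded becomes blue. For a connected graph $G$ and nonempty $Z\subseteq V(G)$, $\mathrm{pt}_{\rm pzf}(G,Z)$ is the random variable equal to the number of the round in which the last white vertex turns blue when starting with exactly $Z$ blue; $\operatorname{ept}(G,Z)=\mathbf{E}[\mathrm{pt}_{\rm pzf}(G,Z)]$ and $\operatorname{ept}(G)=\min_{v\in V(G)}\operatorname{ept}(G,\{v\})$. -}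

module Defs where

open import Data.Bool using (Bool; true; false; _∧_; _∨_; if_then_else_)
open import Data.Nat as ℕ using (ℕ; zero; suc; _^_; _≤ᵇ_)
open import Data.Fin as Fin using (Fin; toℕ)
open import Data.Vec as Vec using (Vec; []; _∷_; lookup; tabulate)
open import Data.List as List using (List; _++_; upTo; allFin)
open import Data.Nat.ListAction using (sum)
open import Data.Integer using (+_)
open import Data.Rational as ℚ using (ℚ; 0ℚ; 1ℚ; _+_; _*_; _-_; _÷_; _⊓_; _/_; ≢-nonZero)
open import Data.Rational.Properties using () renaming (_≟_ to _≟ℚ_)
open import Relation.Nullary using (yes; no; does)

Graph : ℕ → Set
Graph n = Fin n → Fin n → Bool

countFin : ∀ {n} → (Fin n → Bool) → ℕ
countFin {zero}  f = 0
countFin {suc n} f = (if f Fin.zero then 1 else 0) ℕ.+ countFin (λ i → f (Fin.suc i))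

sumQ : ∀ {n} → (Fin n → ℚ) → ℚ
sumQ {zero}  f = 0ℚ
sumQ {suc n} f = f Fin.zero + sumQ (λ i → f (Fin.suc i))

prodQ : ∀ {n} → (Fin n → ℚ) → ℚ
prodQ {zero}  f = 1ℚ
prodQ {suc n} f = f Fin.zero * prodQ (λ i → f (Fin.suc i))

sumList : List ℚ → ℚ
sumList = List.foldr _+_ 0ℚ

-- a / d as a rational (convention: value 0 when d = 0; never used
-- in a situation where it matters)
ratio : ℕ → ℕ → ℚ
ratio a zero    = 0ℚ
ratio a (suc d) = (+ a) / suc d

-- division of rationals (convention: x / 0 = 0; only applied with
-- nonzero denominator for connected graphs)
divQ : ℚ → ℚ → ℚ
divQ x y with y ≟ℚ 0ℚ
... | yes _ = 0ℚ
... | no ne = _÷_ x y {{≢-nonZero ne}}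

-- a coloring: true = blue, false = white
Coloring : ℕ → Set
Coloring n = Vec Bool n

deg : ∀ {n} → Graph n → Fin n → ℕ
deg G u = countFin (G u)

closedBlue : ∀ {n} → Graph n → Coloring n → Fin n → ℕ
closedBlue G B u =
  (if lookup B u then 1 else 0) ℕ.+ countFin (λ j → G u j ∧ lookup B j)

fireProb : ∀ {n} → Graph n → Coloring n → Fin n → ℚ
fireProb G B u = ratio (closedBlue G B u) (deg G u)

-- probability that white vertex w turns blue in a round started with B
-- (at least one of the independent fires from its blue neighbours succeeds)
turnProb : ∀ {n} → Graph n → Coloring n → Fin n → ℚ
turnProb G B w =
  1ℚ - prodQ (λ u → if G w u ∧ lookup B u then 1ℚ - fireProb G B u else 1ℚ)

-- probability that a round started with blue set B ends with blue set B'
-- (B' is assumed to be a superset of B)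
transProb : ∀ {n} → Graph n → Coloring n → Coloring n → ℚ
transProb G B B' =
  prodQ (λ w → if lookup B w then 1ℚ
               else (if lookup B' w then turnProb G B w else 1ℚ - turnProb G B w))

supersets : ∀ {n} → Coloring n → List (Coloring n)
supersets []          = List.[ [] ]
supersets (true ∷ s)  = List.map (true ∷_) (supersets s)
supersets (false ∷ s) = List.map (false ∷_) (supersets s) ++ List.map (true ∷_) (supersets s)

properSupersets : ∀ {n} → Coloring n → List (Coloring n)
properSupersets []          = List.[]
properSupersets (true ∷ s)  = List.map (true ∷_) (properSupersets s)
properSupersets (false ∷ s) = List.map (false ∷_) (properSupersets s) ++ List.map (true ∷_) (supersets s)

allBlue : ∀ {n} → Coloring n → Bool
allBlue = Vec.foldr _ _∧_ true

-- This is the expected absorption time of the (monotone) finite Markov chain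
-- on blue sets:  E(B) = 0 if B = V, and otherwise
--   E(B) = (1 + Σ_{B' ⊋ B} P(B,B') E(B')) / (1 - P(B,B)),
-- which is the equation E(B) = 1 + Σ_{B'} P(B,B') E(B') solved for E(B).
-- The fuel argument bounds the number of white vertices (n suffices).
expRounds : ∀ {n} → ℕ → Graph n → Coloring n → ℚ
expRounds zero    G B = 0ℚ
expRounds (suc f) G B =
  if allBlue B then 0ℚ
  else divQ (1ℚ + sumList (List.map (λ B' → transProb G B B' * expRounds f G B')
                                    (properSupersets B)))
            (1ℚ - transProb G B B)

eptFrom : ∀ {n} → Graph n → Coloring n → ℚ
eptFrom {n} G Z = expRounds n G Z

singleton : ∀ {n} → Fin n → Coloring n
singleton v = tabulate (λ i → does (i Fin.≟ v))

ept : ∀ {n} → Graph n → ℚ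
ept {zero}  G = 0ℚ
ept {suc n} G =
  List.foldr (λ v acc → eptFrom G (singleton v) ⊓ acc)
             (eptFrom G (singleton Fin.zero)) (allFin (suc n))

-- order n = Σ_{d=0}^{h} k^d  ( = (k^{h+1}-1)/(k-1) )
order : ℕ → ℕ → ℕ
order k h = sum (List.map (k ^_) (upTo (suc h)))

-- heap labelling: vertex i is the parent of vertex j iff k*i+1 ≤ j ≤ k*i+k
isParent : ℕ → ℕ → ℕ → Bool
isParent k i j = (suc (k ℕ.* i) ≤ᵇ j) ∧ (j ≤ᵇ k ℕ.* i ℕ.+ k)

tree : (k h : ℕ) → Graph (order k h)
tree k h u v = isParent k (toℕ u) (toℕ v) ∨ isParent k (toℕ v) (toℕ u)

{-# OPTIONS --safe #-}
-- Since (k − 1) n + 1 = k ^ (h + 1), the lower bound says ept(T_{k,h}) ≥ h. In one round the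
-- blue set spreads along at most one edge, so the minimum over the blue vertices of a function
-- that is 1-Lipschitz along edges decreases by at most one per round. Taking h − depth inside
-- the subtree of the first (or last) child of the root and depth + h elsewhere gives such a
-- function vanishing at a leaf, and for every start vertex one of the two is at least h.
--
-- For the upper bound start at the root and let d(v) be the number of white vertices on the
-- path from the root to v. The topmost of them has a blue parent, of degree at most k + 1, so
-- it turns blue with probability at least 1/(k+1): in expectation 2^d(v) − 1, and hence also
-- Φ = Σ_v (2^d(v) − 1) ≤ 2^((k+1)h+1), shrinks by the factor 1 − 1/(2(k+1)) every round. The
-- smoothed logarithm Σ_j 2^(−j) min(Φ, 2^j) of Φ then decreases by a constant in expectation,
-- so the expected number of rounds is O(k² h) = O((log n)²).
module Submission where

open import Defs
open import Data.Bool using (Bool; true; false; _∧_; _∨_; if_then_else_; not; T)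
import Data.Bool.Properties as Boolₚ
open import Data.Empty using (⊥-elim)
open import Data.Fin as Fin using (Fin; toℕ; fromℕ<)
import Data.Fin.Properties as Finₚ
import Data.Integer as ℤ
import Data.Integer.Properties as ℤₚ
open import Data.List as List using (List; _++_; allFin)
import Data.List.Properties as Listₚ
open import Data.List.Relation.Unary.All as All using (All; []; _∷_)
import Data.List.Relation.Unary.All.Properties as Allₚ
open import Data.Nat as ℕ using (ℕ; zero; suc; z≤n; s≤s)
open import Data.Nat.Coprimality using (1-coprimeTo) renaming (sym to coprime-sym)
open import Data.Nat.DivMod using (m/n≤m; m/n*n≤m; m%n<n; m≡m%n+[m/n]*n; m*n/n≡m; /-monoˡ-≤; m<n*o⇒m/o<n)
open import Data.Nat.Induction using (<-rec)
open import Data.Nat.ListAction using (sum)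
open import Data.Nat.ListAction.Properties using (sum-++)
open import Data.Nat.Logarithm using (⌊log₂_⌋; ⌊log₂⌋-mono-≤; ⌊log₂[2^n]⌋≡n)
import Data.Nat.Properties as ℕₚ
open import Data.Product using (_×_; _,_; proj₁; proj₂; ∃)
open import Data.Rational as ℚ using (ℚ; 0ℚ; 1ℚ; ½; mkℚ)
import Data.Rational.Properties as ℚₚ
import Data.Rational.Solver as ℚ-Solver
import Data.Rational.Unnormalised as ℚᵘ
import Data.Rational.Unnormalised.Properties as ℚᵘₚ
open import Data.Sum using (_⊎_; inj₁; inj₂)
open import Data.Vec using (Vec; []; _∷_; lookup)
import Data.Vec.Functional as VecF
import Data.Vec.Properties as Vecₚ
open import Function using (_∘_; id; case_of_)
open import Function.Bundles using (module Equivalence)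
open import Relation.Binary.Definitions using (tri<; tri≈; tri>)
open import Relation.Binary.PropositionalEquality
  using (_≡_; _≢_; refl; sym; trans; cong; cong₂; subst; subst₂; module ≡-Reasoning)
open import Relation.Nullary using (yes; no; does)
import Relation.Nullary.Decidable

module _ where
  open import Data.Integer using (+_)
  open import Data.Rational using (_+_; _*_; _-_; _≤_; _<_; _/_)
  open ℚ-Solver.+-*-Solver using (solve; _:=_; _:+_; _:*_; _:-_; con)

  fromℕ : ℕ → ℚ
  fromℕ n = + n / 1

  fromℕ≡mkℚ : ∀ n → fromℕ n ≡ mkℚ (+ n) 0 (coprime-sym (1-coprimeTo n))
  fromℕ≡mkℚ n = ℚₚ.normalize-coprime (coprime-sym (1-coprimeTo n))

  fromℕ-+ : ∀ a b → fromℕ (a ℕ.+ b) ≡ fromℕ a + fromℕ b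
  fromℕ-+ a b rewrite fromℕ≡mkℚ a | fromℕ≡mkℚ b =
    cong (_/ 1) (sym (trans (cong₂ ℤ._+_ (ℤₚ.*-identityʳ (+ a)) (ℤₚ.*-identityʳ (+ b))) (sym (ℤₚ.pos-+ a b))))

  fromℕ-* : ∀ a b → fromℕ (a ℕ.* b) ≡ fromℕ a * fromℕ b
  fromℕ-* a b rewrite fromℕ≡mkℚ a | fromℕ≡mkℚ b = cong (_/ 1) (ℤₚ.pos-* a b)

  /-mono-≤ : ∀ a d b e → a ℕ.* suc e ℕ.≤ b ℕ.* suc d → + a / suc d ≤ + b / suc e
  /-mono-≤ a d b e ad≤be = ℚₚ.toℚᵘ-cancel-≤
    (ℚᵘₚ.≤-respˡ-≃ (ℚᵘₚ.≃-sym (ℚₚ.toℚᵘ-fromℚᵘ (ℚᵘ.mkℚᵘ (+ a) d)))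
    (ℚᵘₚ.≤-respʳ-≃ (ℚᵘₚ.≃-sym (ℚₚ.toℚᵘ-fromℚᵘ (ℚᵘ.mkℚᵘ (+ b) e)))
      (ℚᵘ.*≤* (subst₂ ℤ._≤_ (ℤₚ.pos-* a (suc e)) (ℤₚ.pos-* b (suc d)) (ℤ.+≤+ ad≤be)))))

  fromℕ-mono-≤ : ∀ {a b} → a ℕ.≤ b → fromℕ a ≤ fromℕ b
  fromℕ-mono-≤ {a} {b} a≤b =
    /-mono-≤ a 0 b 0 (subst₂ ℕ._≤_ (sym (ℕₚ.*-identityʳ a)) (sym (ℕₚ.*-identityʳ b)) a≤b)

  0≤fromℕ : ∀ a → 0ℚ ≤ fromℕ a
  0≤fromℕ a = fromℕ-mono-≤ {0} {a} z≤n

  0≤ratio : ∀ a d → 0ℚ ≤ ratio a d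
  0≤ratio a zero    = ℚₚ.≤-refl
  0≤ratio a (suc d) = /-mono-≤ 0 0 a d z≤n

  ratio≤1 : ∀ {a d} → a ℕ.≤ d → ratio a d ≤ 1ℚ
  ratio≤1 {a} {zero}  _   = ℚₚ.<⇒≤ (ℚₚ.positive⁻¹ 1ℚ)
  ratio≤1 {a} {suc d} a≤d =
    /-mono-≤ a d 1 0 (subst₂ ℕ._≤_ (sym (ℕₚ.*-identityʳ a)) (sym (ℕₚ.+-identityʳ (suc d))) a≤d)

  1/[1+K]≤ratio : ∀ {a d} K → 1 ℕ.≤ a → 1 ℕ.≤ d → d ℕ.≤ suc K → ratio 1 (suc K) ≤ ratio a d
  1/[1+K]≤ratio {a} {suc d} K 1≤a _ d≤K = /-mono-≤ 1 K a d (begin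
    1 ℕ.* suc d   ≡⟨ ℕₚ.*-identityˡ (suc d) ⟩
    suc d         ≤⟨ d≤K ⟩
    suc K         ≡⟨ ℕₚ.*-identityˡ (suc K) ⟨
    1 ℕ.* suc K   ≤⟨ ℕₚ.*-monoˡ-≤ (suc K) 1≤a ⟩
    a ℕ.* suc K   ∎)
    where open ℕₚ.≤-Reasoning

  0<1/[1+K] : ∀ K → 0ℚ < ratio 1 (suc K)
  0<1/[1+K] K = ℚₚ.positive⁻¹ (ratio 1 (suc K)) {{ℚₚ.normalize-pos 1 (suc K)}}

  fromℕ-*-1/[1+K] : ∀ K → fromℕ (suc K) * ratio 1 (suc K) ≡ 1ℚ
  fromℕ-*-1/[1+K] K =
    trans (cong₂ _*_ (fromℕ≡mkℚ (suc K)) (ℚₚ.normalize-coprime (1-coprimeTo (suc K))))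
          (ℚₚ.*-inverseʳ (mkℚ (+ suc K) 0 (coprime-sym (1-coprimeTo (suc K)))))

module _ where
  open import Data.Rational using (_+_; _*_; _-_; -_; _≤_; _<_; _÷_)
  open ℚ-Solver.+-*-Solver using (solve; _:=_; _:+_; _:*_; _:-_; con)

  0≤q-p⇒p≤q : ∀ {p q} → 0ℚ ≤ q - p → p ≤ q
  0≤q-p⇒p≤q {p} {q} 0≤q-p =
    subst₂ _≤_ (ℚₚ.+-identityˡ p) (solve 2 (λ p q → (q :- p) :+ p := q) refl p q) (ℚₚ.+-monoˡ-≤ p 0≤q-p)

  p≤q⇒0≤q-p : ∀ {p q} → p ≤ q → 0ℚ ≤ q - p
  p≤q⇒0≤q-p {p} {q} p≤q = subst (_≤ q - p) (ℚₚ.+-inverseʳ p) (ℚₚ.+-monoˡ-≤ (- p) p≤q)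

  fromℕ[1+n]-1 : ∀ n → fromℕ (suc n) - 1ℚ ≡ fromℕ n
  fromℕ[1+n]-1 n = trans (cong (_- 1ℚ) (fromℕ-+ 1 n)) (solve 1 (λ x → (con 1ℚ :+ x) :- con 1ℚ := x) refl (fromℕ n))

  *-nonNeg : ∀ {p q} → 0ℚ ≤ p → 0ℚ ≤ q → 0ℚ ≤ p * q
  *-nonNeg {p} {q} 0≤p 0≤q = subst (_≤ p * q) (ℚₚ.*-zeroʳ p) (ℚₚ.*-monoˡ-≤-nonNeg p {{ℚ.nonNegative 0≤p}} 0≤q)

  *-mono-≤-nonNeg : ∀ {p q r s} → 0ℚ ≤ p → 0ℚ ≤ r → p ≤ q → r ≤ s → p * r ≤ q * s
  *-mono-≤-nonNeg {p} {q} {r} {s} 0≤p 0≤r p≤q r≤s = 0≤q-p⇒p≤q (subst (0ℚ ≤_) eq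
    (ℚₚ.+-mono-≤ (*-nonNeg (p≤q⇒0≤q-p p≤q) (ℚₚ.≤-trans 0≤r r≤s)) (*-nonNeg 0≤p (p≤q⇒0≤q-p r≤s))))
    where
    eq : (q - p) * s + p * (s - r) ≡ q * s - p * r
    eq = solve 4 (λ p q r s → (q :- p) :* s :+ p :* (s :- r) := q :* s :- p :* r) refl p q r s

  Prob : ℚ → Set
  Prob p = 0ℚ ≤ p × p ≤ 1ℚ

  Prob-1 : Prob 1ℚ
  Prob-1 = ℚₚ.<⇒≤ (ℚₚ.positive⁻¹ 1ℚ) , ℚₚ.≤-refl

  Prob-* : ∀ {p q} → Prob p → Prob q → Prob (p * q)
  Prob-* (0≤p , p≤1) (0≤q , q≤1) = *-nonNeg 0≤p 0≤q , *-mono-≤-nonNeg 0≤p 0≤q p≤1 q≤1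

  Prob-1- : ∀ {p} → Prob p → Prob (1ℚ - p)
  Prob-1- {p} (0≤p , p≤1) =
    p≤q⇒0≤q-p p≤1 , 0≤q-p⇒p≤q (subst (0ℚ ≤_) (solve 1 (λ p → p := con 1ℚ :- (con 1ℚ :- p)) refl p) 0≤p)

  Prob-ratio : ∀ {a d} → a ℕ.≤ d → Prob (ratio a d)
  Prob-ratio {a} {d} a≤d = 0≤ratio a d , ratio≤1 a≤d

  *-≤ˡ : ∀ {p q} → 0ℚ ≤ p → Prob q → p * q ≤ p
  *-≤ˡ {p} {q} 0≤p (0≤q , q≤1) = subst (p * q ≤_) (ℚₚ.*-identityʳ p) (*-mono-≤-nonNeg 0≤p 0≤q ℚₚ.≤-refl q≤1)

  *-≤ʳ : ∀ {p q} → Prob p → 0ℚ ≤ q → p * q ≤ q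
  *-≤ʳ {p} {q} (0≤p , p≤1) 0≤q = subst (p * q ≤_) (ℚₚ.*-identityˡ q) (*-mono-≤-nonNeg 0≤p 0≤q p≤1 ℚₚ.≤-refl)

  ÷-*-cancel : ∀ p q .{{_ : ℚ.NonZero q}} → (p ÷ q) * q ≡ p
  ÷-*-cancel p q = trans (ℚₚ.*-assoc p _ q) (trans (cong (p *_) (ℚₚ.*-inverseˡ q)) (ℚₚ.*-identityʳ p))

  divQ≤ : ∀ {p q r} → 0ℚ ≤ r → 0ℚ ≤ q → p ≤ r * q → divQ p q ≤ r
  divQ≤ {p} {q} {r} 0≤r 0≤q p≤rq with q ℚₚ.≟ 0ℚ
  ... | yes _  = 0≤r
  ... | no q≢0 = ℚₚ.*-cancelʳ-≤-pos q {{ℚ.positive 0<q}}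
                   (subst (_≤ r * q) (sym (÷-*-cancel p q {{ℚ.≢-nonZero q≢0}})) p≤rq)
    where
    0<q : 0ℚ < q
    0<q = ℚₚ.≰⇒> (λ q≤0 → q≢0 (ℚₚ.≤-antisym q≤0 0≤q))

  ≤divQ : ∀ {p q r} → 0ℚ < q → r * q ≤ p → r ≤ divQ p q
  ≤divQ {p} {q} {r} 0<q rq≤p with q ℚₚ.≟ 0ℚ
  ... | yes q≡0 = ⊥-elim (ℚₚ.<⇒≢ 0<q (sym q≡0))
  ... | no q≢0  = ℚₚ.*-cancelʳ-≤-pos q {{ℚ.positive 0<q}}
                    (subst (r * q ≤_) (sym (÷-*-cancel p q {{ℚ.≢-nonZero q≢0}})) rq≤p)

module _ where
  open import Data.Rational using (_+_; _-_; _≤_)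
  open ℚ-Solver.+-*-Solver using (solve; _:=_; _:-_; con)

  swap-1- : ∀ {p q} → p ≤ 1ℚ - q → q ≤ 1ℚ - p
  swap-1- {p} {q} p≤1-q = 0≤q-p⇒p≤q (subst (0ℚ ≤_)
    (solve 2 (λ p q → (con 1ℚ :- q) :- p := (con 1ℚ :- p) :- q) refl p q) (p≤q⇒0≤q-p p≤1-q))

  ≤-via-difference : ∀ {a b c d} → a ≤ b → d - c ≡ b - a → c ≤ d
  ≤-via-difference a≤b eq = 0≤q-p⇒p≤q (subst (0ℚ ≤_) (sym eq) (p≤q⇒0≤q-p a≤b))

  1-antimono : ∀ {p q} → p ≤ q → 1ℚ - q ≤ 1ℚ - p
  1-antimono p≤q = ℚₚ.+-monoʳ-≤ 1ℚ (ℚₚ.neg-antimono-≤ p≤q)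

module _ where
  open import Data.Rational using (_+_; _*_; _-_; _≤_)
  open ℚ-Solver.+-*-Solver using (solve; _:=_; _:+_; _:*_; _:-_; con)

  sumMap : ∀ {A : Set} → (A → ℚ) → List A → ℚ
  sumMap f xs = sumList (List.map f xs)

  sumMap-++ : ∀ {A : Set} (f : A → ℚ) xs ys → sumMap f (xs ++ ys) ≡ sumMap f xs + sumMap f ys
  sumMap-++ f List.[]       ys = sym (ℚₚ.+-identityˡ _)
  sumMap-++ f (x List.∷ xs) ys = trans (cong (f x +_) (sumMap-++ f xs ys)) (sym (ℚₚ.+-assoc (f x) _ _))

  sumMap-map : ∀ {A B : Set} (f : B → ℚ) (g : A → B) xs → sumMap f (List.map g xs) ≡ sumMap (f ∘ g) xs
  sumMap-map f g List.[]       = refl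
  sumMap-map f g (x List.∷ xs) = cong (f (g x) +_) (sumMap-map f g xs)

  sumMap-*ˡ : ∀ {A : Set} c (f : A → ℚ) xs → sumMap (λ x → c * f x) xs ≡ c * sumMap f xs
  sumMap-*ˡ c f List.[]       = sym (ℚₚ.*-zeroʳ c)
  sumMap-*ˡ c f (x List.∷ xs) = trans (cong (c * f x +_) (sumMap-*ˡ c f xs)) (sym (ℚₚ.*-distribˡ-+ c (f x) _))

  sumMap-+ : ∀ {A : Set} (f g : A → ℚ) xs → sumMap (λ x → f x + g x) xs ≡ sumMap f xs + sumMap g xs
  sumMap-+ f g List.[]       = refl
  sumMap-+ f g (x List.∷ xs) = trans (cong (f x + g x +_) (sumMap-+ f g xs))
    (solve 4 (λ a b c d → (a :+ b) :+ (c :+ d) := (a :+ c) :+ (b :+ d)) refl (f x) (g x) (sumMap f xs) (sumMap g xs))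

  sumMap-zero : ∀ {A : Set} (xs : List A) → sumMap (λ _ → 0ℚ) xs ≡ 0ℚ
  sumMap-zero List.[]       = refl
  sumMap-zero (x List.∷ xs) = trans (ℚₚ.+-identityˡ _) (sumMap-zero xs)

  sumMap-cong : ∀ {A : Set} {f g : A → ℚ} xs → All (λ x → f x ≡ g x) xs → sumMap f xs ≡ sumMap g xs
  sumMap-cong List.[]       []            = refl
  sumMap-cong (x List.∷ xs) (fx≡gx ∷ eqs) = cong₂ _+_ fx≡gx (sumMap-cong xs eqs)

  sumMap-mono : ∀ {A : Set} {f g : A → ℚ} xs → All (λ x → f x ≤ g x) xs → sumMap f xs ≤ sumMap g xs
  sumMap-mono List.[]       []            = ℚₚ.≤-refl
  sumMap-mono (x List.∷ xs) (fx≤gx ∷ les) = ℚₚ.+-mono-≤ fx≤gx (sumMap-mono xs les)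

  sumQ-sub : ∀ {n} (f g : Fin n → ℚ) → sumQ (λ i → f i - g i) ≡ sumQ f - sumQ g
  sumQ-sub {zero}  f g = refl
  sumQ-sub {suc n} f g = trans (cong (f Fin.zero - g Fin.zero +_) (sumQ-sub (f ∘ Fin.suc) (g ∘ Fin.suc)))
    (solve 4 (λ a b c d → (a :- b) :+ (c :- d) := (a :+ c) :- (b :+ d)) refl
      (f Fin.zero) (g Fin.zero) (sumQ (f ∘ Fin.suc)) (sumQ (g ∘ Fin.suc)))

  sumQ-*ˡ : ∀ {n} c (f : Fin n → ℚ) → sumQ (λ i → c * f i) ≡ c * sumQ f
  sumQ-*ˡ {zero}  c f = sym (ℚₚ.*-zeroʳ c)
  sumQ-*ˡ {suc n} c f = trans (cong (c * f Fin.zero +_) (sumQ-*ˡ c (f ∘ Fin.suc))) (sym (ℚₚ.*-distribˡ-+ c _ _))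

  sumQ-mono : ∀ {n} {f g : Fin n → ℚ} → (∀ i → f i ≤ g i) → sumQ f ≤ sumQ g
  sumQ-mono {zero}  f≤g = ℚₚ.≤-refl
  sumQ-mono {suc n} f≤g = ℚₚ.+-mono-≤ (f≤g Fin.zero) (sumQ-mono (f≤g ∘ Fin.suc))

  sumQ-nonNeg : ∀ {n} {f : Fin n → ℚ} → (∀ i → 0ℚ ≤ f i) → 0ℚ ≤ sumQ f
  sumQ-nonNeg {zero}  0≤f = ℚₚ.≤-refl
  sumQ-nonNeg {suc n} 0≤f = ℚₚ.+-mono-≤ (0≤f Fin.zero) (sumQ-nonNeg (0≤f ∘ Fin.suc))

  term≤sumQ : ∀ {n} {f : Fin n → ℚ} → (∀ i → 0ℚ ≤ f i) → ∀ j → f j ≤ sumQ f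
  term≤sumQ {suc n} {f} 0≤f Fin.zero =
    subst (_≤ sumQ f) (ℚₚ.+-identityʳ (f Fin.zero)) (ℚₚ.+-monoʳ-≤ (f Fin.zero) (sumQ-nonNeg (0≤f ∘ Fin.suc)))
  term≤sumQ {suc n} {f} 0≤f (Fin.suc j) = ℚₚ.≤-trans (term≤sumQ (0≤f ∘ Fin.suc) j)
    (subst (_≤ sumQ f) (ℚₚ.+-identityˡ _) (ℚₚ.+-monoˡ-≤ _ (0≤f Fin.zero)))

  sumQ-const : ∀ n c → sumQ {n} (λ _ → c) ≡ fromℕ n * c
  sumQ-const zero    c = sym (ℚₚ.*-zeroˡ c)
  sumQ-const (suc n) c = trans (cong (c +_) (sumQ-const n c))
    (trans (solve 2 (λ c m → c :+ m :* c := (con 1ℚ :+ m) :* c) refl c (fromℕ n)) (cong (_* c) (sym (fromℕ-+ 1 n))))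

  sumℕ : ∀ {n} → (Fin n → ℕ) → ℕ
  sumℕ = VecF.foldr ℕ._+_ 0

  sumQ-fromℕ : ∀ {n} (f : Fin n → ℕ) → sumQ (fromℕ ∘ f) ≡ fromℕ (sumℕ f)
  sumQ-fromℕ {zero}  f = refl
  sumQ-fromℕ {suc n} f = trans (cong (fromℕ (f Fin.zero) +_) (sumQ-fromℕ (f ∘ Fin.suc))) (sym (fromℕ-+ (f Fin.zero) _))

  term≤sumℕ : ∀ {n} (f : Fin n → ℕ) i → f i ℕ.≤ sumℕ f
  term≤sumℕ {suc n} f Fin.zero    = ℕₚ.m≤m+n _ _
  term≤sumℕ {suc n} f (Fin.suc i) = ℕₚ.≤-trans (term≤sumℕ (f ∘ Fin.suc) i) (ℕₚ.m≤n+m _ _)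

  sumℕ≤ : ∀ {n} (f : Fin n → ℕ) {M} → (∀ i → f i ℕ.≤ M) → sumℕ f ℕ.≤ n ℕ.* M
  sumℕ≤ {zero}  f f≤M = z≤n
  sumℕ≤ {suc n} f f≤M = ℕₚ.+-mono-≤ (f≤M Fin.zero) (sumℕ≤ (f ∘ Fin.suc) (f≤M ∘ Fin.suc))

  sumMap-sumQ : ∀ {A : Set} {n} (F : Fin n → A → ℚ) xs →
                sumMap (λ x → sumQ (λ v → F v x)) xs ≡ sumQ (λ v → sumMap (F v) xs)
  sumMap-sumQ {n = zero}  F xs = sumMap-zero xs
  sumMap-sumQ {n = suc n} F xs = trans (sumMap-+ (F Fin.zero) (λ x → sumQ (λ v → F (Fin.suc v) x)) xs)
    (cong (sumMap (F Fin.zero) xs +_) (sumMap-sumQ (F ∘ Fin.suc) xs))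

  prodQ-cong : ∀ {n} {f g : Fin n → ℚ} → (∀ i → f i ≡ g i) → prodQ f ≡ prodQ g
  prodQ-cong {zero}  f≗g = refl
  prodQ-cong {suc n} f≗g = cong₂ _*_ (f≗g Fin.zero) (prodQ-cong (f≗g ∘ Fin.suc))

  prodQ-1 : ∀ n → prodQ {n} (λ _ → 1ℚ) ≡ 1ℚ
  prodQ-1 zero    = refl
  prodQ-1 (suc n) = cong (1ℚ *_) (prodQ-1 n)

  prodQ-Prob : ∀ {n} {f : Fin n → ℚ} → (∀ i → Prob (f i)) → Prob (prodQ f)
  prodQ-Prob {zero}  _     = Prob-1
  prodQ-Prob {suc n} Prob-f = Prob-* (Prob-f Fin.zero) (prodQ-Prob (Prob-f ∘ Fin.suc))

  prodQ≤factor : ∀ {n} {f : Fin n → ℚ} → (∀ i → Prob (f i)) → ∀ j → prodQ f ≤ f j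
  prodQ≤factor {suc n} Prob-f Fin.zero    = *-≤ˡ (proj₁ (Prob-f Fin.zero)) (prodQ-Prob (Prob-f ∘ Fin.suc))
  prodQ≤factor {suc n} Prob-f (Fin.suc j) =
    ℚₚ.≤-trans (*-≤ʳ (Prob-f Fin.zero) (proj₁ (prodQ-Prob (Prob-f ∘ Fin.suc)))) (prodQ≤factor (Prob-f ∘ Fin.suc) j)

  prodQ-zero : ∀ {n} {f : Fin n → ℚ} j → f j ≡ 0ℚ → prodQ f ≡ 0ℚ
  prodQ-zero {suc n} {f} Fin.zero    fj≡0 = trans (cong (_* prodQ (f ∘ Fin.suc)) fj≡0) (ℚₚ.*-zeroˡ (prodQ (f ∘ Fin.suc)))
  prodQ-zero {suc n} {f} (Fin.suc j) fj≡0 = trans (cong (f Fin.zero *_) (prodQ-zero j fj≡0)) (ℚₚ.*-zeroʳ (f Fin.zero))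

  prodQ-update : ∀ {n} (f g : Fin n → ℚ) j c → (∀ i → i ≢ j → g i ≡ f i) → g j ≡ f j * c →
                 prodQ g ≡ prodQ f * c
  prodQ-update {suc n} f g Fin.zero c g≗f gj≡fjc =
    trans (cong₂ _*_ gj≡fjc (prodQ-cong (λ i → g≗f (Fin.suc i) λ ())))
          (solve 3 (λ a c p → (a :* c) :* p := (a :* p) :* c) refl (f Fin.zero) c (prodQ (f ∘ Fin.suc)))
  prodQ-update {suc n} f g (Fin.suc j) c g≗f gj≡fjc =
    trans (cong₂ _*_ (g≗f Fin.zero λ ())
                     (prodQ-update (f ∘ Fin.suc) (g ∘ Fin.suc) j c (λ i i≢j → g≗f (Fin.suc i) (i≢j ∘ Finₚ.suc-injective)) gj≡fjc))
          (sym (ℚₚ.*-assoc (f Fin.zero) _ c))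

module _ where
  open import Data.Nat using (_+_; _≤_)

  countFin-mono : ∀ {n} {f g : Fin n → Bool} → (∀ j → f j ≡ true → g j ≡ true) → countFin f ≤ countFin g
  countFin-mono {zero} f⇒g = z≤n
  countFin-mono {suc n} {f} {g} f⇒g with f Fin.zero in f₀ | g Fin.zero in g₀
  ... | true  | true  = s≤s (countFin-mono (f⇒g ∘ Fin.suc))
  ... | true  | false = case trans (sym (f⇒g Fin.zero f₀)) g₀ of λ ()
  ... | false | true  = ℕₚ.m≤n⇒m≤1+n (countFin-mono (f⇒g ∘ Fin.suc))
  ... | false | false = countFin-mono (f⇒g ∘ Fin.suc)

  countFin-< : ∀ {n} {f g : Fin n → Bool} → (∀ j → f j ≡ true → g j ≡ true) →
               ∀ i → g i ≡ true → f i ≡ false → suc (countFin f) ≤ countFin g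
  countFin-< {suc n} {f} {g} f⇒g Fin.zero gi fi rewrite gi | fi = s≤s (countFin-mono (f⇒g ∘ Fin.suc))
  countFin-< {suc n} {f} {g} f⇒g (Fin.suc i) gi fi with f Fin.zero in f₀ | g Fin.zero in g₀
  ... | true  | true  = s≤s (countFin-< (f⇒g ∘ Fin.suc) i gi fi)
  ... | true  | false = case trans (sym (f⇒g Fin.zero f₀)) g₀ of λ ()
  ... | false | true  = ℕₚ.m≤n⇒m≤1+n (countFin-< (f⇒g ∘ Fin.suc) i gi fi)
  ... | false | false = countFin-< (f⇒g ∘ Fin.suc) i gi fi

  countFin-pos : ∀ {n} {g : Fin n → Bool} i → g i ≡ true → 1 ≤ countFin g
  countFin-pos i gi = ℕₚ.≤-trans (s≤s z≤n) (countFin-< {f = λ _ → false} (λ _ ()) i gi refl)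

  countFin-∨ : ∀ {n} (f g : Fin n → Bool) → countFin (λ j → f j ∨ g j) ≤ countFin f + countFin g
  countFin-∨ {zero}  f g = z≤n
  countFin-∨ {suc n} f g with f Fin.zero | g Fin.zero
  ... | true  | true  = s≤s (ℕₚ.≤-trans (countFin-∨ (f ∘ Fin.suc) (g ∘ Fin.suc))
                                        (ℕₚ.+-monoʳ-≤ (countFin (f ∘ Fin.suc)) (ℕₚ.n≤1+n _)))
  ... | true  | false = s≤s (countFin-∨ (f ∘ Fin.suc) (g ∘ Fin.suc))
  ... | false | true  = subst (suc (countFin (λ j → f (Fin.suc j) ∨ g (Fin.suc j))) ≤_) (sym (ℕₚ.+-suc _ _))
                          (s≤s (countFin-∨ (f ∘ Fin.suc) (g ∘ Fin.suc)))
  ... | false | false = countFin-∨ (f ∘ Fin.suc) (g ∘ Fin.suc)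

_⊆_ : ∀ {n} → Coloring n → Coloring n → Set
B ⊆ B′ = ∀ i → lookup B i ≡ true → lookup B′ i ≡ true

module _ where
  open import Data.Rational using (_+_; _*_)

  ∷-⊆ : ∀ {n} {b c} {B B′ : Coloring n} → (b ≡ true → c ≡ true) → B ⊆ B′ → (b ∷ B) ⊆ (c ∷ B′)
  ∷-⊆ b⇒c B⊆B′ Fin.zero    = b⇒c
  ∷-⊆ b⇒c B⊆B′ (Fin.suc i) = B⊆B′ i

  supersets-⊇ : ∀ {n} (B : Coloring n) → All (B ⊆_) (supersets B)
  supersets-⊇ []          = (λ ()) ∷ []
  supersets-⊇ (true ∷ B)  = Allₚ.map⁺ (All.map (∷-⊆ id) (supersets-⊇ B))
  supersets-⊇ (false ∷ B) = Allₚ.++⁺ (Allₚ.map⁺ (All.map (∷-⊆ id) (supersets-⊇ B)))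
                                     (Allₚ.map⁺ (All.map (∷-⊆ λ _ → refl) (supersets-⊇ B)))

  properSupersets-⊇ : ∀ {n} (B : Coloring n) → All (B ⊆_) (properSupersets B)
  properSupersets-⊇ []          = []
  properSupersets-⊇ (true ∷ B)  = Allₚ.map⁺ (All.map (∷-⊆ id) (properSupersets-⊇ B))
  properSupersets-⊇ (false ∷ B) = Allₚ.++⁺ (Allₚ.map⁺ (All.map (∷-⊆ id) (properSupersets-⊇ B)))
                                           (Allₚ.map⁺ (All.map (∷-⊆ λ _ → refl) (supersets-⊇ B)))

  sumMap-supersets : ∀ {n} (f : Coloring n → ℚ) B → sumMap f (supersets B) ≡ f B + sumMap f (properSupersets B)
  sumMap-supersets f [] = refl
  sumMap-supersets f (true ∷ B) = begin
    sumMap f (List.map (true ∷_) (supersets B))                ≡⟨ sumMap-map f (true ∷_) (supersets B) ⟩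
    sumMap (f ∘ (true ∷_)) (supersets B)                       ≡⟨ sumMap-supersets (f ∘ (true ∷_)) B ⟩
    f (true ∷ B) + sumMap (f ∘ (true ∷_)) (properSupersets B)  ≡⟨ cong (f (true ∷ B) +_) (sumMap-map f (true ∷_) (properSupersets B)) ⟨
    f (true ∷ B) + sumMap f (List.map (true ∷_) (properSupersets B)) ∎
    where open ≡-Reasoning
  sumMap-supersets f (false ∷ B) = begin
    sumMap f (List.map (false ∷_) (supersets B) ++ ones)
      ≡⟨ sumMap-++ f (List.map (false ∷_) (supersets B)) ones ⟩
    sumMap f (List.map (false ∷_) (supersets B)) + rest
      ≡⟨ cong (_+ rest) (trans (sumMap-map f (false ∷_) (supersets B)) (sumMap-supersets (f ∘ (false ∷_)) B)) ⟩
    (f (false ∷ B) + sumMap (f ∘ (false ∷_)) (properSupersets B)) + rest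
      ≡⟨ ℚₚ.+-assoc (f (false ∷ B)) _ rest ⟩
    f (false ∷ B) + (sumMap (f ∘ (false ∷_)) (properSupersets B) + rest)
      ≡⟨ cong (λ s → f (false ∷ B) + (s + rest)) (sumMap-map f (false ∷_) (properSupersets B)) ⟨
    f (false ∷ B) + (sumMap f (List.map (false ∷_) (properSupersets B)) + rest)
      ≡⟨ cong (f (false ∷ B) +_) (sumMap-++ f (List.map (false ∷_) (properSupersets B)) ones) ⟨
    f (false ∷ B) + sumMap f (List.map (false ∷_) (properSupersets B) ++ ones) ∎
    where
    open ≡-Reasoning
    ones = List.map (true ∷_) (supersets B)
    rest = sumMap f ones

  sumMap-supersets-prodQ : ∀ {n} (B : Coloring n) (a : Fin n → Bool → ℚ) →
    sumMap (λ B′ → prodQ (λ w → a w (lookup B′ w))) (supersets B)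
      ≡ prodQ (λ w → if lookup B w then a w true else a w false + a w true)
  sumMap-supersets-prodQ [] a = refl
  sumMap-supersets-prodQ (true ∷ B) a = begin
    sumMap (λ B′ → prodQ (λ w → a w (lookup B′ w))) (List.map (true ∷_) (supersets B))
      ≡⟨ sumMap-map _ (true ∷_) (supersets B) ⟩
    sumMap (λ B′ → a Fin.zero true * tailProd B′) (supersets B)
      ≡⟨ sumMap-*ˡ (a Fin.zero true) tailProd (supersets B) ⟩
    a Fin.zero true * sumMap tailProd (supersets B)
      ≡⟨ cong (a Fin.zero true *_) (sumMap-supersets-prodQ B (a ∘ Fin.suc)) ⟩
    _ ∎
    where
    open ≡-Reasoning
    tailProd = λ (B′ : Coloring _) → prodQ (λ i → a (Fin.suc i) (lookup B′ i))
  sumMap-supersets-prodQ (false ∷ B) a = begin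
    sumMap (λ B′ → prodQ (λ w → a w (lookup B′ w))) (List.map (false ∷_) (supersets B) ++ List.map (true ∷_) (supersets B))
      ≡⟨ sumMap-++ _ (List.map (false ∷_) (supersets B)) (List.map (true ∷_) (supersets B)) ⟩
    _ ≡⟨ cong₂ _+_ (sumMap-map _ (false ∷_) (supersets B)) (sumMap-map _ (true ∷_) (supersets B)) ⟩
    sumMap (λ B′ → a₀ false * tailProd B′) (supersets B) + sumMap (λ B′ → a₀ true * tailProd B′) (supersets B)
      ≡⟨ cong₂ _+_ (sumMap-*ˡ (a₀ false) tailProd (supersets B)) (sumMap-*ˡ (a₀ true) tailProd (supersets B)) ⟩
    a₀ false * sumMap tailProd (supersets B) + a₀ true * sumMap tailProd (supersets B)
      ≡⟨ ℚₚ.*-distribʳ-+ (sumMap tailProd (supersets B)) (a₀ false) (a₀ true) ⟨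
    (a₀ false + a₀ true) * sumMap tailProd (supersets B)
      ≡⟨ cong ((a₀ false + a₀ true) *_) (sumMap-supersets-prodQ B (a ∘ Fin.suc)) ⟩
    _ ∎
    where
    open ≡-Reasoning
    a₀ = a Fin.zero
    tailProd = λ (B′ : Coloring _) → prodQ (λ i → a (Fin.suc i) (lookup B′ i))

allBlue≡false⇒white : ∀ {n} (B : Coloring n) → allBlue B ≡ false → ∃ λ i → lookup B i ≡ false
allBlue≡false⇒white (true ∷ B)  ≡false = let i , Bi≡false = allBlue≡false⇒white B ≡false in Fin.suc i , Bi≡false
allBlue≡false⇒white (false ∷ B) _      = Fin.zero , refl

allBlue⇒blue : ∀ {n} (B : Coloring n) → allBlue B ≡ true → ∀ i → lookup B i ≡ true
allBlue⇒blue (true ∷ B) ≡true Fin.zero    = refl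
allBlue⇒blue (true ∷ B) ≡true (Fin.suc i) = allBlue⇒blue B ≡true i

singleton-self : ∀ {n} (v : Fin n) → lookup (singleton v) v ≡ true
singleton-self v rewrite Vecₚ.lookup∘tabulate (λ i → does (i Fin.≟ v)) v with v Fin.≟ v
... | yes _   = refl
... | no v≢v = ⊥-elim (v≢v refl)

singleton-unique : ∀ {n} (v u : Fin n) → lookup (singleton v) u ≡ true → u ≡ v
singleton-unique v u u∈ rewrite Vecₚ.lookup∘tabulate (λ i → does (i Fin.≟ v)) u with u Fin.≟ v
... | yes u≡v = u≡v

𝟙 : Bool → ℚ
𝟙 b = if b then 1ℚ else 0ℚ

-- One round of probabilistic zero forcing

module RoundChain {n : ℕ} (G : Graph n) (G-sym : ∀ u v → G u v ≡ G v u) where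
  open import Data.Rational using (_+_; _*_; _-_; _≤_; _<_)
  open ℚ-Solver.+-*-Solver using (solve; _:=_; _:+_; _:*_; _:-_; con)

  closedBlue≤deg : ∀ B {u w} → lookup B u ≡ true → G u w ≡ true → lookup B w ≡ false →
                   closedBlue G B u ℕ.≤ deg G u
  closedBlue≤deg B {u} {w} Bu Guw Bw rewrite Bu =
    countFin-< (λ j → Boolₚ.∧-conicalˡ (G u j) (lookup B j)) w Guw
               (trans (cong (G u w ∧_) Bw) (Boolₚ.∧-zeroʳ (G u w)))

  fireProb-Prob : ∀ B {u w} → lookup B u ≡ true → G u w ≡ true → lookup B w ≡ false → Prob (fireProb G B u)
  fireProb-Prob B Bu Guw Bw = Prob-ratio (closedBlue≤deg B Bu Guw Bw)

  1/[1+K]≤fireProb : ∀ B {u w} K → lookup B u ≡ true → G u w ≡ true → deg G u ℕ.≤ suc K →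
                     ratio 1 (suc K) ≤ fireProb G B u
  1/[1+K]≤fireProb B {u} {w} K Bu Guw deg≤ = 1/[1+K]≤ratio K 1≤closedBlue (countFin-pos w Guw) deg≤
    where
    1≤closedBlue : 1 ℕ.≤ closedBlue G B u
    1≤closedBlue rewrite Bu = s≤s z≤n

  failProb : Coloring n → Fin n → Fin n → ℚ
  failProb B w u = if G w u ∧ lookup B u then 1ℚ - fireProb G B u else 1ℚ

  failProb-Prob : ∀ B {w} → lookup B w ≡ false → ∀ u → Prob (failProb B w u)
  failProb-Prob B {w} Bw u with G w u ∧ lookup B u in Gwu∧Bu
  ... | true  = Prob-1- (fireProb-Prob B (Boolₚ.∧-conicalʳ (G w u) _ Gwu∧Bu)
                                       (trans (G-sym u w) (Boolₚ.∧-conicalˡ _ _ Gwu∧Bu)) Bw)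
  ... | false = Prob-1

  turnProb-Prob : ∀ B {w} → lookup B w ≡ false → Prob (turnProb G B w)
  turnProb-Prob B Bw = Prob-1- (prodQ-Prob (failProb-Prob B Bw))

  1/[1+K]≤turnProb : ∀ B {w u} K → lookup B w ≡ false → G w u ≡ true → lookup B u ≡ true →
                     deg G u ℕ.≤ suc K → ratio 1 (suc K) ≤ turnProb G B w
  1/[1+K]≤turnProb B {w} {u} K Bw Gwu Bu deg≤ = swap-1- (begin
    prodQ (failProb B w)        ≤⟨ prodQ≤factor (failProb-Prob B Bw) u ⟩
    failProb B w u              ≡⟨ cong (λ b → if b ∧ lookup B u then 1ℚ - fireProb G B u else 1ℚ) Gwu ⟩
    (if lookup B u then 1ℚ - fireProb G B u else 1ℚ) ≡⟨ cong (if_then 1ℚ - fireProb G B u else 1ℚ) Bu ⟩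
    1ℚ - fireProb G B u         ≤⟨ 1-antimono (1/[1+K]≤fireProb B K Bu (trans (G-sym u w) Gwu) deg≤) ⟩
    1ℚ - ratio 1 (suc K)        ∎)
    where open ℚₚ.≤-Reasoning

  turnProb-isolated : ∀ B {w} → (∀ u → (G w u ∧ lookup B u) ≡ false) → turnProb G B w ≡ 0ℚ
  turnProb-isolated B {w} noBlue =
    trans (cong (1ℚ -_) (trans (prodQ-cong fail≡1) (prodQ-1 n))) (ℚₚ.+-inverseʳ 1ℚ)
    where
    fail≡1 : ∀ u → failProb B w u ≡ 1ℚ
    fail≡1 u rewrite noBlue u = refl

  transFactor : Coloring n → Fin n → Bool → ℚ
  transFactor B w b = if lookup B w then 1ℚ else (if b then turnProb G B w else 1ℚ - turnProb G B w)

  transFactor-Prob : ∀ B w b → Prob (transFactor B w b)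
  transFactor-Prob B w b with lookup B w in Bw | b
  ... | true  | _     = Prob-1
  ... | false | true  = turnProb-Prob B Bw
  ... | false | false = Prob-1- (turnProb-Prob B Bw)

  transFactor-total : ∀ B w → (if lookup B w then transFactor B w true
                                else transFactor B w false + transFactor B w true) ≡ 1ℚ
  transFactor-total B w with lookup B w
  ... | true  = refl
  ... | false = solve 1 (λ t → (con 1ℚ :- t) :+ t := con 1ℚ) refl (turnProb G B w)

  transProb-Prob : ∀ B B′ → Prob (transProb G B B′)
  transProb-Prob B B′ = prodQ-Prob (λ w → transFactor-Prob B w (lookup B′ w))

  transProb-nonNeg : ∀ B B′ → 0ℚ ≤ transProb G B B′
  transProb-nonNeg B B′ = proj₁ (transProb-Prob B B′)

  transProb-sum : ∀ B → sumMap (transProb G B) (supersets B) ≡ 1ℚ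
  transProb-sum B =
    trans (sumMap-supersets-prodQ B (transFactor B)) (trans (prodQ-cong (transFactor-total B)) (prodQ-1 n))

  transProb-isolated : ∀ B B′ {w} → lookup B w ≡ false → lookup B′ w ≡ true →
                       (∀ u → (G w u ∧ lookup B u) ≡ false) → transProb G B B′ ≡ 0ℚ
  transProb-isolated B B′ {w} Bw B′w noBlue = prodQ-zero w factor≡0
    where
    factor≡0 : transFactor B w (lookup B′ w) ≡ 0ℚ
    factor≡0 rewrite Bw | B′w = turnProb-isolated B noBlue

  leaveProb : ∀ B → sumMap (transProb G B) (properSupersets B) ≡ 1ℚ - transProb G B B
  leaveProb B = begin
    sumMap P (properSupersets B)               ≡⟨ solve 2 (λ s p → s := (p :+ s) :- p) refl _ (P B) ⟩
    (P B + sumMap P (properSupersets B)) - P B ≡⟨ cong (_- P B) (sumMap-supersets P B) ⟨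
    sumMap P (supersets B) - P B               ≡⟨ cong (_- P B) (transProb-sum B) ⟩
    1ℚ - P B                                   ∎
    where
    open ≡-Reasoning
    P = transProb G B

  0<leaveProb : ∀ B {w u} → lookup B w ≡ false → lookup B u ≡ true → G w u ≡ true →
                0ℚ < 1ℚ - transProb G B B
  0<leaveProb B {w} {u} Bw Bu Gwu = begin-strict
    0ℚ                           <⟨ 0<1/[1+K] (deg G u) ⟩
    ratio 1 (suc (deg G u))      ≤⟨ 1/[1+K]≤turnProb B (deg G u) Bw Gwu Bu (ℕₚ.n≤1+n _) ⟩
    turnProb G B w               ≤⟨ swap-1- stay≤ ⟩
    1ℚ - transProb G B B         ∎
    where
    open ℚₚ.≤-Reasoning
    stayFactor : transFactor B w (lookup B w) ≡ 1ℚ - turnProb G B w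
    stayFactor rewrite Bw = refl
    stay≤ : transProb G B B ≤ 1ℚ - turnProb G B w
    stay≤ = subst (transProb G B B ≤_) stayFactor (prodQ≤factor (λ i → transFactor-Prob B i (lookup B i)) w)

  𝔼 : Coloring n → (Coloring n → ℚ) → ℚ
  𝔼 B F = sumMap (λ B′ → transProb G B B′ * F B′) (supersets B)

  𝔼-const : ∀ B c → 𝔼 B (λ _ → c) ≡ c
  𝔼-const B c = begin
    sumMap (λ B′ → transProb G B B′ * c) (supersets B)
      ≡⟨ sumMap-cong (supersets B) (All.universal (λ B′ → ℚₚ.*-comm (transProb G B B′) c) _) ⟩
    sumMap (λ B′ → c * transProb G B B′) (supersets B) ≡⟨ sumMap-*ˡ c (transProb G B) (supersets B) ⟩
    c * sumMap (transProb G B) (supersets B)           ≡⟨ cong (c *_) (transProb-sum B) ⟩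
    c * 1ℚ                                              ≡⟨ ℚₚ.*-identityʳ c ⟩
    c                                                   ∎
    where open ≡-Reasoning

  𝔼-cong : ∀ B {F H} → (∀ B′ → F B′ ≡ H B′) → 𝔼 B F ≡ 𝔼 B H
  𝔼-cong B F≗H = sumMap-cong (supersets B) (All.universal (λ B′ → cong (transProb G B B′ *_) (F≗H B′)) _)

  𝔼-+ : ∀ B F H → 𝔼 B (λ B′ → F B′ + H B′) ≡ 𝔼 B F + 𝔼 B H
  𝔼-+ B F H = trans (sumMap-cong (supersets B) (All.universal (λ B′ → ℚₚ.*-distribˡ-+ (transProb G B B′) (F B′) (H B′)) _))
                    (sumMap-+ _ _ (supersets B))

  𝔼-*ˡ : ∀ B c F → 𝔼 B (λ B′ → c * F B′) ≡ c * 𝔼 B F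
  𝔼-*ˡ B c F = trans (sumMap-cong (supersets B) (All.universal (λ B′ → solve 3 (λ p c f → p :* (c :* f) := c :* (p :* f)) refl
                                                              (transProb G B B′) c (F B′)) _))
                     (sumMap-*ˡ c _ (supersets B))

  𝔼-mono : ∀ B {F H} → (∀ B′ → B ⊆ B′ → F B′ ≤ H B′) → 𝔼 B F ≤ 𝔼 B H
  𝔼-mono B F≤H = sumMap-mono (supersets B) (All.map (λ {B′} B⊆B′ →
    ℚₚ.*-monoˡ-≤-nonNeg (transProb G B B′) {{ℚ.nonNegative (transProb-nonNeg B B′)}} (F≤H B′ B⊆B′)) (supersets-⊇ B))

  𝔼-sumQ : ∀ B {m} (F : Fin m → Coloring n → ℚ) → 𝔼 B (λ B′ → sumQ (λ v → F v B′)) ≡ sumQ (λ v → 𝔼 B (F v))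
  𝔼-sumQ B F = trans (sumMap-cong (supersets B) (All.universal (λ B′ → sym (sumQ-*ˡ (transProb G B B′) (λ v → F v B′))) _))
                     (sumMap-sumQ (λ v B′ → transProb G B B′ * F v B′) (supersets B))

  𝔼-𝟙 : ∀ B {w} → lookup B w ≡ false → 𝔼 B (λ B′ → 𝟙 (lookup B′ w)) ≡ turnProb G B w
  𝔼-𝟙 B {w} Bw = begin
    𝔼 B (λ B′ → 𝟙 (lookup B′ w))
      ≡⟨ sumMap-cong (supersets B) (All.universal (λ B′ →
           sym (prodQ-update _ _ w _ (λ i → marked-off (lookup B′ i)) (marked-on (lookup B′ w)))) _) ⟩
    sumMap (λ B′ → prodQ (λ u → marked u (lookup B′ u))) (supersets B)
      ≡⟨ sumMap-supersets-prodQ B marked ⟩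
    prodQ (λ u → if lookup B u then marked u true else marked u false + marked u true)
      ≡⟨ prodQ-update (λ _ → 1ℚ) _ w (turnProb G B w) unmarked-total marked-total ⟩
    prodQ {n} (λ _ → 1ℚ) * turnProb G B w
      ≡⟨ trans (cong (_* turnProb G B w) (prodQ-1 n)) (ℚₚ.*-identityˡ _) ⟩
    turnProb G B w ∎
    where
    open ≡-Reasoning
    does-yes : does (w Fin.≟ w) ≡ true
    does-yes = Relation.Nullary.Decidable.dec-true (w Fin.≟ w) refl
    does-no : ∀ {i} → i ≢ w → does (i Fin.≟ w) ≡ false
    does-no = Relation.Nullary.Decidable.dec-false (_ Fin.≟ w)
    marked : Fin n → Bool → ℚ
    marked u b = if does (u Fin.≟ w) then transFactor B u b * 𝟙 b else transFactor B u b
    marked-off : ∀ {i} b → i ≢ w → marked i b ≡ transFactor B i b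
    marked-off b i≢w rewrite does-no i≢w = refl
    marked-on : ∀ b → marked w b ≡ transFactor B w b * 𝟙 b
    marked-on b rewrite does-yes = refl
    unmarked-total : ∀ i → i ≢ w → (if lookup B i then marked i true else marked i false + marked i true) ≡ 1ℚ
    unmarked-total i i≢w rewrite does-no i≢w = transFactor-total B i
    marked-total : (if lookup B w then marked w true else marked w false + marked w true) ≡ 1ℚ * turnProb G B w
    marked-total rewrite does-yes | Bw =
      solve 1 (λ t → (con 1ℚ :- t) :* con 0ℚ :+ t :* con 1ℚ := con 1ℚ :* t) refl (turnProb G B w)

  𝔼-affine-𝟙 : ∀ B {w} → lookup B w ≡ false → ∀ a c → 𝔼 B (λ B′ → a + c * 𝟙 (lookup B′ w)) ≡ a + c * turnProb G B w
  𝔼-affine-𝟙 B {w} Bw a c = trans (𝔼-+ B (λ _ → a) (λ B′ → c * 𝟙 (lookup B′ w)))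
    (cong₂ _+_ (𝔼-const B a) (trans (𝔼-*ˡ B c (λ B′ → 𝟙 (lookup B′ w))) (cong (c *_) (𝔼-𝟙 B Bw))))

  BoundaryEdge : Coloring n → Set
  BoundaryEdge B = ∃ λ w → ∃ λ u → lookup B w ≡ false × lookup B u ≡ true × G w u ≡ true

  0≤leaveProb : ∀ B → 0ℚ ≤ 1ℚ - transProb G B B
  0≤leaveProb B = proj₁ (Prob-1- (transProb-Prob B B))

  expRounds≤potential :
    (Inv : Coloring n → Set) → (∀ {B B′} → Inv B → B ⊆ B′ → Inv B′) →
    (φ : Coloring n → ℚ) → (∀ B → 0ℚ ≤ φ B) →
    (∀ B → Inv B → allBlue B ≡ false → 1ℚ + 𝔼 B φ ≤ φ B) →
    ∀ f B → Inv B → expRounds f G B ≤ φ B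
  expRounds≤potential Inv Inv-⊆ φ 0≤φ drift zero    B InvB = 0≤φ B
  expRounds≤potential Inv Inv-⊆ φ 0≤φ drift (suc f) B InvB with allBlue B in full
  ... | true  = 0≤φ B
  ... | false = divQ≤ (0≤φ B) (0≤leaveProb B) (begin
    1ℚ + sumMap (λ B′ → P B′ * expRounds f G B′) (properSupersets B) ≤⟨ ℚₚ.+-monoʳ-≤ 1ℚ (sumMap-mono _ IH) ⟩
    1ℚ + S                                                           ≤⟨ ≤-via-difference drift′ eq ⟩
    φ B * (1ℚ - P B)                                                 ∎)
    where
    open ℚₚ.≤-Reasoning
    P = transProb G B
    S = sumMap (λ B′ → P B′ * φ B′) (properSupersets B)
    IH : All (λ B′ → P B′ * expRounds f G B′ ≤ P B′ * φ B′) (properSupersets B)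
    IH = All.map (λ {B′} B⊆B′ → ℚₚ.*-monoˡ-≤-nonNeg (P B′) {{ℚ.nonNegative (transProb-nonNeg B B′)}}
                   (expRounds≤potential Inv Inv-⊆ φ 0≤φ drift f B′ (Inv-⊆ InvB B⊆B′)))
                 (properSupersets-⊇ B)
    drift′ : 1ℚ + (P B * φ B + S) ≤ φ B
    drift′ = subst (λ e → 1ℚ + e ≤ φ B) (sumMap-supersets (λ B′ → P B′ * φ B′) B) (drift B InvB full)
    eq : φ B * (1ℚ - P B) - (1ℚ + S) ≡ φ B - (1ℚ + (P B * φ B + S))
    eq = solve 3 (λ φ p s → φ :* (con 1ℚ :- p) :- (con 1ℚ :+ s) := φ :- (con 1ℚ :+ (p :* φ :+ s))) refl (φ B) (P B) S

  -- The cut-off at f accounts for the fuel of expRounds.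
  potential≤expRounds :
    (Inv : Coloring n → Set) → (∀ {B B′} → Inv B → B ⊆ B′ → Inv B′) →
    (∀ B → Inv B → allBlue B ≡ false → BoundaryEdge B) →
    (ψ : Coloring n → ℕ) → (∀ B → allBlue B ≡ true → ψ B ≡ 0) →
    (∀ {B B′} → B ⊆ B′ → transProb G B B′ ≢ 0ℚ → ψ B ℕ.∸ 1 ℕ.≤ ψ B′) →
    ∀ f B → Inv B → fromℕ (ψ B ℕ.⊓ f) ≤ expRounds f G B
  potential≤expRounds Inv Inv-⊆ boundary ψ ψ-full ψ-drop zero B InvB =
    ℚₚ.≤-reflexive (cong fromℕ (ℕₚ.⊓-zeroʳ (ψ B)))
  potential≤expRounds Inv Inv-⊆ boundary ψ ψ-full ψ-drop (suc f) B InvB with allBlue B in full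
  ... | true  = ℚₚ.≤-reflexive (cong (λ m → fromℕ (m ℕ.⊓ suc f)) (ψ-full B full))
  ... | false = ≤divQ 0<D (begin
    fromℕ m * D                  ≤⟨ ℚₚ.*-monoʳ-≤-nonNeg D {{ℚ.nonNegative (0≤leaveProb B)}} m≤1+m-1 ⟩
    (1ℚ + fromℕ (m ℕ.∸ 1)) * D   ≤⟨ ≤-via-difference (proj₂ (Prob-1- (transProb-Prob B B))) eq ⟩
    1ℚ + fromℕ (m ℕ.∸ 1) * D     ≤⟨ ℚₚ.+-monoʳ-≤ 1ℚ (subst (_≤ S) sum≡ (sumMap-mono _ IH)) ⟩
    1ℚ + S                       ∎)
    where
    open ℚₚ.≤-Reasoning
    P = transProb G B
    D = 1ℚ - P B
    S = sumMap (λ B′ → P B′ * expRounds f G B′) (properSupersets B)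
    m = ψ B ℕ.⊓ suc f
    0<D : 0ℚ < D
    0<D = let w , u , Bw , Bu , Gwu = boundary B InvB full in 0<leaveProb B Bw Bu Gwu
    m≤1+m-1 : fromℕ m ≤ 1ℚ + fromℕ (m ℕ.∸ 1)
    m≤1+m-1 = subst (fromℕ m ≤_) (fromℕ-+ 1 (m ℕ.∸ 1)) (fromℕ-mono-≤ (ℕₚ.m≤n+m∸n m 1))
    eq : (1ℚ + fromℕ (m ℕ.∸ 1) * D) - (1ℚ + fromℕ (m ℕ.∸ 1)) * D ≡ 1ℚ - D
    eq = solve 2 (λ x d → (con 1ℚ :+ x :* d) :- (con 1ℚ :+ x) :* d := con 1ℚ :- d) refl (fromℕ (m ℕ.∸ 1)) D
    m-1≤ : ∀ {B′} → B ⊆ B′ → P B′ ≢ 0ℚ → m ℕ.∸ 1 ℕ.≤ ψ B′ ℕ.⊓ f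
    m-1≤ {B′} B⊆B′ P≢0 = subst (ℕ._≤ ψ B′ ℕ.⊓ f) (sym (ℕₚ.∸-distribʳ-⊓ 1 (ψ B) (suc f))) (ℕₚ.⊓-monoˡ-≤ f (ψ-drop B⊆B′ P≢0))
    zero* : ∀ {p} x → p ≡ 0ℚ → p * x ≡ 0ℚ
    zero* x refl = ℚₚ.*-zeroˡ x
    IH-at : ∀ {B′} → B ⊆ B′ → P B′ * fromℕ (m ℕ.∸ 1) ≤ P B′ * expRounds f G B′
    IH-at {B′} B⊆B′ with P B′ ℚₚ.≟ 0ℚ
    ... | yes P≡0 = ℚₚ.≤-reflexive (trans (zero* (fromℕ (m ℕ.∸ 1)) P≡0) (sym (zero* (expRounds f G B′) P≡0)))
    ... | no P≢0  = ℚₚ.*-monoˡ-≤-nonNeg (P B′) {{ℚ.nonNegative (transProb-nonNeg B B′)}}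
                      (ℚₚ.≤-trans (fromℕ-mono-≤ (m-1≤ {B′} B⊆B′ P≢0))
                        (potential≤expRounds Inv Inv-⊆ boundary ψ ψ-full ψ-drop f B′ (Inv-⊆ InvB B⊆B′)))
    IH : All (λ B′ → P B′ * fromℕ (m ℕ.∸ 1) ≤ P B′ * expRounds f G B′) (properSupersets B)
    IH = All.map IH-at (properSupersets-⊇ B)
    sum≡ : sumMap (λ B′ → P B′ * fromℕ (m ℕ.∸ 1)) (properSupersets B) ≡ fromℕ (m ℕ.∸ 1) * D
    sum≡ = trans (sumMap-cong (properSupersets B) (All.universal (λ B′ → ℚₚ.*-comm (P B′) (fromℕ (m ℕ.∸ 1))) _))
                 (trans (sumMap-*ˡ (fromℕ (m ℕ.∸ 1)) P (properSupersets B)) (cong (fromℕ (m ℕ.∸ 1) *_) (leaveProb B)))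

-- Drift bounds for arbitrary graphs

module _ where
  open import Data.Rational using (_≤_; _⊓_)

  foldr-⊓≤init : ∀ {A : Set} (e : A → ℚ) z xs → List.foldr (λ v acc → e v ⊓ acc) z xs ≤ z
  foldr-⊓≤init e z List.[]       = ℚₚ.≤-refl
  foldr-⊓≤init e z (x List.∷ xs) = ℚₚ.≤-trans (ℚₚ.p⊓q≤q (e x) _) (foldr-⊓≤init e z xs)

  ≤foldr-⊓ : ∀ {A : Set} (e : A → ℚ) {z} xs {q} → q ≤ z → (∀ v → q ≤ e v) → q ≤ List.foldr (λ v acc → e v ⊓ acc) z xs
  ≤foldr-⊓ e List.[]       q≤z q≤e = q≤z
  ≤foldr-⊓ e (x List.∷ xs) q≤z q≤e = ℚₚ.⊓-glb (q≤e x) (≤foldr-⊓ e xs q≤z q≤e)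

  ept≤eptFrom-zero : ∀ {n} (G : Graph (suc n)) → ept G ≤ eptFrom G (singleton Fin.zero)
  ept≤eptFrom-zero {n} G = foldr-⊓≤init (λ v → eptFrom G (singleton v)) _ (allFin (suc n))

  ≤ept : ∀ {n} (G : Graph (suc n)) {q} → (∀ v → q ≤ eptFrom G (singleton v)) → q ≤ ept G
  ≤ept {n} G q≤ = ≤foldr-⊓ (λ v → eptFrom G (singleton v)) (allFin (suc n)) (q≤ Fin.zero) q≤

module _ where
  open import Data.Nat using (_*_; _^_; _≤_)

  dyadicScale : ∀ J {x} → 1 ≤ x → x ≤ 2 ^ J → ∃ λ j → j ≤ J × x ≤ 2 ^ j × 2 ^ j ≤ 2 * x
  dyadicScale zero    {x} 1≤x x≤1 = 0 , z≤n , x≤1 , ℕₚ.≤-trans 1≤x (ℕₚ.m≤m+n x _)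
  dyadicScale (suc J) {x} 1≤x x≤2^J+1 with x ℕₚ.≤? 2 ^ J
  ... | yes x≤2^J = let j , j≤J , x≤2^j , 2^j≤2x = dyadicScale J 1≤x x≤2^J in j , ℕₚ.m≤n⇒m≤1+n j≤J , x≤2^j , 2^j≤2x
  ... | no  x≰2^J = suc J , ℕₚ.≤-refl , x≤2^J+1 , ℕₚ.*-monoʳ-≤ 2 (ℕₚ.<⇒≤ (ℕₚ.≰⇒> x≰2^J))

module _ where
  open import Data.Rational using (_*_; _≤_)
  open ℚ-Solver.+-*-Solver using (solve; _:=_; _:*_)

  halfPow : ℕ → ℚ
  halfPow zero    = 1ℚ
  halfPow (suc j) = ½ * halfPow j

  0≤halfPow : ∀ j → 0ℚ ≤ halfPow j
  0≤halfPow zero    = proj₁ Prob-1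
  0≤halfPow (suc j) = *-nonNeg (0≤ratio 1 2) (0≤halfPow j)

  halfPow-*-2^ : ∀ j → halfPow j * fromℕ (2 ℕ.^ j) ≡ 1ℚ
  halfPow-*-2^ zero    = refl
  halfPow-*-2^ (suc j) = begin
    (½ * halfPow j) * fromℕ (2 ℕ.* 2 ℕ.^ j)               ≡⟨ cong ((½ * halfPow j) *_) (fromℕ-* 2 (2 ℕ.^ j)) ⟩
    (½ * halfPow j) * (fromℕ 2 * fromℕ (2 ℕ.^ j))          ≡⟨ solve 4 (λ h w t x → (h :* w) :* (t :* x) := (t :* h) :* (w :* x)) refl
                                                                     ½ (halfPow j) (fromℕ 2) (fromℕ (2 ℕ.^ j)) ⟩
    (fromℕ 2 * ½) * (halfPow j * fromℕ (2 ℕ.^ j))          ≡⟨ cong₂ _*_ (fromℕ-*-1/[1+K] 1) (halfPow-*-2^ j) ⟩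
    1ℚ                                                    ∎
    where open ≡-Reasoning

  1≤2*halfPow*x : ∀ j {x} → 2 ℕ.^ j ℕ.≤ 2 ℕ.* x → 1ℚ ≤ fromℕ 2 * (halfPow j * fromℕ x)
  1≤2*halfPow*x j {x} 2^j≤2x = begin
    1ℚ                                   ≡⟨ halfPow-*-2^ j ⟨
    halfPow j * fromℕ (2 ℕ.^ j)          ≤⟨ ℚₚ.*-monoˡ-≤-nonNeg (halfPow j) {{ℚ.nonNegative (0≤halfPow j)}} (fromℕ-mono-≤ 2^j≤2x) ⟩
    halfPow j * fromℕ (2 ℕ.* x)          ≡⟨ cong (halfPow j *_) (fromℕ-* 2 x) ⟩
    halfPow j * (fromℕ 2 * fromℕ x)      ≡⟨ solve 3 (λ w t f → w :* (t :* f) := t :* (w :* f)) refl (halfPow j) (fromℕ 2) (fromℕ x) ⟩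
    fromℕ 2 * (halfPow j * fromℕ x)      ∎
    where open ℚₚ.≤-Reasoning

module MultiplicativeDrift {n : ℕ} (G : Graph n) (G-sym : ∀ u v → G u v ≡ G v u) where
  open RoundChain G G-sym
  open import Data.Rational using (_+_; _*_; _-_; _≤_; _⊓_)
  open ℚ-Solver.+-*-Solver using (solve; _:=_; _:+_; _:*_; _:-_; con)

  𝔼-⊓ : ∀ B F c → 𝔼 B (λ B′ → F B′ ⊓ c) ≤ 𝔼 B F ⊓ c
  𝔼-⊓ B F c = ℚₚ.⊓-glb (𝔼-mono B (λ B′ _ → ℚₚ.p⊓q≤p (F B′) c))
                       (subst (𝔼 B (λ B′ → F B′ ⊓ c) ≤_) (𝔼-const B c) (𝔼-mono B (λ B′ _ → ℚₚ.p⊓q≤q (F B′) c)))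

  1-ρ*y≤y : ∀ {ρ y} → 0ℚ ≤ ρ → 0ℚ ≤ y → (1ℚ - ρ) * y ≤ y
  1-ρ*y≤y {ρ} {y} 0≤ρ 0≤y =
    ≤-via-difference (*-nonNeg 0≤ρ 0≤y) (solve 2 (λ r y → y :- (con 1ℚ :- r) :* y := r :* y :- con 0ℚ) refl ρ y)

  capped : ℕ → ℚ → ℚ
  capped j y = halfPow j * (y ⊓ fromℕ (2 ℕ.^ j))

  0≤capped : ∀ j {y} → 0ℚ ≤ y → 0ℚ ≤ capped j y
  0≤capped j 0≤y = *-nonNeg (0≤halfPow j) (ℚₚ.⊓-glb 0≤y (0≤fromℕ (2 ℕ.^ j)))

  capped-mono : ∀ j {y y′} → y ≤ y′ → capped j y ≤ capped j y′
  capped-mono j y≤y′ = ℚₚ.*-monoˡ-≤-nonNeg (halfPow j) {{ℚ.nonNegative (0≤halfPow j)}} (ℚₚ.⊓-monoˡ-≤ _ y≤y′)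

  capped≤1 : ∀ j y → capped j y ≤ 1ℚ
  capped≤1 j y = ℚₚ.≤-trans (ℚₚ.*-monoˡ-≤-nonNeg (halfPow j) {{ℚ.nonNegative (0≤halfPow j)}} (ℚₚ.p⊓q≤q y _))
                            (ℚₚ.≤-reflexive (halfPow-*-2^ j))

  𝔼-capped : ∀ B j F → 𝔼 B (λ B′ → capped j (F B′)) ≤ capped j (𝔼 B F)
  𝔼-capped B j F = ℚₚ.≤-trans (ℚₚ.≤-reflexive (𝔼-*ˡ B (halfPow j) (λ B′ → F B′ ⊓ fromℕ (2 ℕ.^ j))))
    (ℚₚ.*-monoˡ-≤-nonNeg (halfPow j) {{ℚ.nonNegative (0≤halfPow j)}} (𝔼-⊓ B F (fromℕ (2 ℕ.^ j))))

  capped-drop : ∀ j {ρ y} → 0ℚ ≤ ρ → 0ℚ ≤ y → y ≤ fromℕ (2 ℕ.^ j) →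
                capped j y - capped j ((1ℚ - ρ) * y) ≡ halfPow j * (ρ * y)
  capped-drop j {ρ} {y} 0≤ρ 0≤y y≤2^j = begin
    capped j y - capped j ((1ℚ - ρ) * y)          ≡⟨ cong₂ (λ a b → halfPow j * a - halfPow j * b)
                                                        (ℚₚ.p≤q⇒p⊓q≡p y≤2^j) (ℚₚ.p≤q⇒p⊓q≡p (ℚₚ.≤-trans (1-ρ*y≤y 0≤ρ 0≤y) y≤2^j)) ⟩
    halfPow j * y - halfPow j * ((1ℚ - ρ) * y)    ≡⟨ solve 3 (λ w r y → w :* y :- w :* ((con 1ℚ :- r) :* y) := w :* (r :* y))
                                                            refl (halfPow j) ρ y ⟩
    halfPow j * (ρ * y)                           ∎
    where open ≡-Reasoning

  module _ (Inv : Coloring n → Set) (Inv-⊆ : ∀ {B B′} → Inv B → B ⊆ B′ → Inv B′)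
           (Φ : Coloring n → ℕ) (J : ℕ) (ρ : ℚ) (c : ℕ) where

    -- fromℕ c times a smoothed log₂ Φ: at the scale j with Φ ≤ 2^j ≤ 2Φ, shrinking Φ by the
    -- factor 1 − ρ lowers the j-th term by at least ρ/2.
    terms : ℚ → Fin (suc J) → ℚ
    terms y i = capped (toℕ i) y

    logPotential : Coloring n → ℚ
    logPotential B = fromℕ c * sumQ (terms (fromℕ (Φ B)))

    0≤logPotential : ∀ B → 0ℚ ≤ logPotential B
    0≤logPotential B = *-nonNeg (0≤fromℕ c) (sumQ-nonNeg {suc J} (λ i → 0≤capped (toℕ i) (0≤fromℕ (Φ B))))

    logPotential≤ : ∀ B → logPotential B ≤ fromℕ c * fromℕ (suc J)
    logPotential≤ B = ℚₚ.*-monoˡ-≤-nonNeg (fromℕ c) {{ℚ.nonNegative (0≤fromℕ c)}}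
      (ℚₚ.≤-trans (sumQ-mono {suc J} (λ i → capped≤1 (toℕ i) (fromℕ (Φ B))))
                  (ℚₚ.≤-reflexive (trans (sumQ-const (suc J) 1ℚ) (ℚₚ.*-identityʳ _))))

    𝔼-logPotential≤ : (∀ B → Inv B → 𝔼 B (fromℕ ∘ Φ) ≤ (1ℚ - ρ) * fromℕ (Φ B)) →
                      ∀ B → Inv B → 𝔼 B logPotential ≤ fromℕ c * sumQ (terms ((1ℚ - ρ) * fromℕ (Φ B)))
    𝔼-logPotential≤ Φ-drift B InvB = begin
      𝔼 B logPotential
        ≡⟨ trans (𝔼-*ˡ B (fromℕ c) _) (cong (fromℕ c *_) (𝔼-sumQ B (λ i B′ → terms (fromℕ (Φ B′)) i))) ⟩
      fromℕ c * sumQ {suc J} (λ i → 𝔼 B (λ B′ → terms (fromℕ (Φ B′)) i))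
        ≤⟨ ℚₚ.*-monoˡ-≤-nonNeg (fromℕ c) {{ℚ.nonNegative (0≤fromℕ c)}} (sumQ-mono {suc J} λ i →
             ℚₚ.≤-trans (𝔼-capped B (toℕ i) (fromℕ ∘ Φ)) (capped-mono (toℕ i) (Φ-drift B InvB))) ⟩
      fromℕ c * sumQ (terms ((1ℚ - ρ) * fromℕ (Φ B))) ∎
      where open ℚₚ.≤-Reasoning

    1≤terms-drop : 0ℚ ≤ ρ → 1ℚ ≤ fromℕ c * (ρ * ½) →
                   ∀ {x j} → j ℕ.≤ J → x ℕ.≤ 2 ℕ.^ j → 2 ℕ.^ j ℕ.≤ 2 ℕ.* x →
                   1ℚ ≤ fromℕ c * (sumQ (terms (fromℕ x)) - sumQ (terms ((1ℚ - ρ) * fromℕ x)))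
    1≤terms-drop 0≤ρ 1≤cρ/2 {x} {j} j≤J x≤2^j 2^j≤2x = begin
      1ℚ
        ≤⟨ *-mono-≤-nonNeg (proj₁ Prob-1) (proj₁ Prob-1) 1≤cρ/2 (1≤2*halfPow*x j {x} 2^j≤2x) ⟩
      (fromℕ c * (ρ * ½)) * (fromℕ 2 * (halfPow j * y))
        ≡⟨ solve 6 (λ c r h t w y → (c :* (r :* h)) :* (t :* (w :* y)) := c :* (w :* (r :* y)) :* (t :* h))
                   refl (fromℕ c) ρ ½ (fromℕ 2) (halfPow j) y ⟩
      fromℕ c * (halfPow j * (ρ * y)) * (fromℕ 2 * ½)
        ≡⟨ trans (cong (fromℕ c * (halfPow j * (ρ * y)) *_) (fromℕ-*-1/[1+K] 1)) (ℚₚ.*-identityʳ _) ⟩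
      fromℕ c * (halfPow j * (ρ * y))
        ≡⟨ cong (fromℕ c *_) drop-at-j ⟨
      fromℕ c * (terms y j′ - terms y′ j′)
        ≤⟨ ℚₚ.*-monoˡ-≤-nonNeg (fromℕ c) {{ℚ.nonNegative (0≤fromℕ c)}} (term≤sumQ 0≤drop j′) ⟩
      fromℕ c * sumQ (λ i → terms y i - terms y′ i)
        ≡⟨ cong (fromℕ c *_) (sumQ-sub (terms y) (terms y′)) ⟩
      fromℕ c * (sumQ (terms y) - sumQ (terms y′)) ∎
      where
      open ℚₚ.≤-Reasoning
      y = fromℕ x
      y′ = (1ℚ - ρ) * y
      j′ : Fin (suc J)
      j′ = fromℕ< (s≤s j≤J)
      drop-at-j : terms y j′ - terms y′ j′ ≡ halfPow j * (ρ * y)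
      drop-at-j rewrite Finₚ.toℕ-fromℕ< (s≤s j≤J) = capped-drop j 0≤ρ (0≤fromℕ x) (fromℕ-mono-≤ x≤2^j)
      0≤drop : ∀ i → 0ℚ ≤ terms y i - terms y′ i
      0≤drop i = p≤q⇒0≤q-p (capped-mono (toℕ i) (1-ρ*y≤y 0≤ρ (0≤fromℕ x)))

    multiplicativeDrift :
      0ℚ ≤ ρ → 1ℚ ≤ fromℕ c * (ρ * ½) →
      (∀ B → allBlue B ≡ false → 1 ℕ.≤ Φ B) → (∀ B → Φ B ℕ.≤ 2 ℕ.^ J) →
      (∀ B → Inv B → 𝔼 B (fromℕ ∘ Φ) ≤ (1ℚ - ρ) * fromℕ (Φ B)) →
      ∀ f B → Inv B → expRounds f G B ≤ fromℕ c * fromℕ (suc J)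
    multiplicativeDrift 0≤ρ 1≤cρ/2 Φ-pos Φ≤2^J Φ-drift f B InvB =
      ℚₚ.≤-trans (expRounds≤potential Inv Inv-⊆ logPotential 0≤logPotential drift f B InvB) (logPotential≤ B)
      where
      drift : ∀ B → Inv B → allBlue B ≡ false → 1ℚ + 𝔼 B logPotential ≤ logPotential B
      drift B InvB full = begin
        1ℚ + 𝔼 B logPotential            ≤⟨ ℚₚ.+-monoʳ-≤ 1ℚ (𝔼-logPotential≤ Φ-drift B InvB) ⟩
        1ℚ + fromℕ c * sumQ (terms y′)    ≤⟨ ≤-via-difference (1≤terms-drop 0≤ρ 1≤cρ/2 j≤J Φ≤2^j 2^j≤2Φ)
                                              (solve 3 (λ c a a′ → c :* a :- (con 1ℚ :+ c :* a′) := c :* (a :- a′) :- con 1ℚ)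
                                                     refl (fromℕ c) (sumQ (terms y)) (sumQ (terms y′))) ⟩
        fromℕ c * sumQ (terms y)          ∎
        where
        open ℚₚ.≤-Reasoning
        y = fromℕ (Φ B)
        y′ = (1ℚ - ρ) * y
        scale = dyadicScale J (Φ-pos B full) (Φ≤2^J B)
        j≤J = proj₁ (proj₂ scale)
        Φ≤2^j = proj₁ (proj₂ (proj₂ scale))
        2^j≤2Φ = proj₂ (proj₂ (proj₂ scale))

module _ where
  open import Data.Nat using (_≤_; _⊓_)

  minOver : ∀ {m} → Vec Bool m → (Fin m → ℕ) → ℕ → ℕ
  minOver []      F d = d
  minOver (b ∷ B) F d = if b then F Fin.zero ⊓ minOver B (F ∘ Fin.suc) d else minOver B (F ∘ Fin.suc) d

  minOver≤default : ∀ {m} (B : Vec Bool m) F d → minOver B F d ≤ d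
  minOver≤default []          F d = ℕₚ.≤-refl
  minOver≤default (true ∷ B)  F d = ℕₚ.≤-trans (ℕₚ.m⊓n≤n _ _) (minOver≤default B (F ∘ Fin.suc) d)
  minOver≤default (false ∷ B) F d = minOver≤default B (F ∘ Fin.suc) d

  minOver≤ : ∀ {m} (B : Vec Bool m) F d {v} → lookup B v ≡ true → minOver B F d ≤ F v
  minOver≤ (true ∷ B)  F d {Fin.zero}  _  = ℕₚ.m⊓n≤m _ _
  minOver≤ (true ∷ B)  F d {Fin.suc v} Bv = ℕₚ.≤-trans (ℕₚ.m⊓n≤n _ _) (minOver≤ B (F ∘ Fin.suc) d Bv)
  minOver≤ (false ∷ B) F d {Fin.suc v} Bv = minOver≤ B (F ∘ Fin.suc) d Bv

  ≤minOver : ∀ {m} (B : Vec Bool m) F d {x} → x ≤ d → (∀ v → lookup B v ≡ true → x ≤ F v) → x ≤ minOver B F d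
  ≤minOver []          F d x≤d x≤F = x≤d
  ≤minOver (true ∷ B)  F d x≤d x≤F = ℕₚ.⊓-glb (x≤F Fin.zero refl) (≤minOver B (F ∘ Fin.suc) d x≤d (x≤F ∘ Fin.suc))
  ≤minOver (false ∷ B) F d x≤d x≤F = ≤minOver B (F ∘ Fin.suc) d x≤d (x≤F ∘ Fin.suc)

module LipschitzLowerBound {n : ℕ} (G : Graph n) (G-sym : ∀ u v → G u v ≡ G v u) where
  open RoundChain G G-sym
  open import Data.Nat using (_∸_; _≤_; _⊓_)
  open import Data.Rational using () renaming (_≤_ to _≤ℚ_)

  1-Lipschitz : (Fin n → ℕ) → Set
  1-Lipschitz F = ∀ u v → G u v ≡ true → F u ≤ suc (F v)

  blueNeighbour? : ∀ B w → (∃ λ u → (G w u ∧ lookup B u) ≡ true) ⊎ (∀ u → (G w u ∧ lookup B u) ≡ false)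
  blueNeighbour? B w with Finₚ.any? (λ u → (G w u ∧ lookup B u) Boolₚ.≟ true)
  ... | yes found = inj₁ found
  ... | no  none  = inj₂ (λ u → Boolₚ.¬-not (λ Gwu∧Bu → none (u , Gwu∧Bu)))

  minOver-drop : ∀ {F} → 1-Lipschitz F → ∀ d {B B′} → B ⊆ B′ → transProb G B B′ ≢ 0ℚ →
                 minOver B F d ∸ 1 ≤ minOver B′ F d
  minOver-drop {F} F-lip d {B} {B′} B⊆B′ P≢0 =
    ≤minOver B′ F d (ℕₚ.≤-trans (ℕₚ.m∸n≤m _ 1) (minOver≤default B F d)) newly-blue
    where
    newly-blue : ∀ v → lookup B′ v ≡ true → minOver B F d ∸ 1 ≤ F v
    newly-blue v B′v with lookup B v in Bv
    ... | true  = ℕₚ.≤-trans (ℕₚ.m∸n≤m _ 1) (minOver≤ B F d Bv)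
    ... | false with blueNeighbour? B v
    ...   | inj₂ none = ⊥-elim (P≢0 (transProb-isolated B B′ Bv B′v none))
    ...   | inj₁ (u , Gvu∧Bu) = ℕₚ.∸-monoˡ-≤ 1 (ℕₚ.≤-trans (minOver≤ B F d (Boolₚ.∧-conicalʳ (G v u) _ Gvu∧Bu))
                                   (F-lip u v (trans (G-sym u v) (Boolₚ.∧-conicalˡ _ _ Gvu∧Bu))))

  Nonempty : Coloring n → Set
  Nonempty B = ∃ λ i → lookup B i ≡ true

  lipschitz≤eptFrom : (∀ B → Nonempty B → allBlue B ≡ false → BoundaryEdge B) →
    ∀ F → 1-Lipschitz F → ∀ z → F z ≡ 0 → ∀ v {d} → d ≤ F v → d ≤ n → fromℕ d ≤ℚ eptFrom G (singleton v)
  lipschitz≤eptFrom boundary F F-lip z Fz≡0 v {d} d≤Fv d≤n =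
    subst (λ m → fromℕ m ≤ℚ eptFrom G (singleton v)) start
      (potential≤expRounds Nonempty (λ (i , Bi) B⊆B′ → i , B⊆B′ i Bi) boundary
                           (λ B → minOver B F d) full (λ {B} {B′} → minOver-drop F-lip d {B} {B′}) n (singleton v) (v , singleton-self v))
    where
    full : ∀ B → allBlue B ≡ true → minOver B F d ≡ 0
    full B all = ℕₚ.n≤0⇒n≡0 (ℕₚ.≤-trans (minOver≤ B F d (allBlue⇒blue B all z)) (ℕₚ.≤-reflexive Fz≡0))
    start : minOver (singleton v) F d ⊓ n ≡ d
    start = trans (cong (_⊓ n) (ℕₚ.≤-antisym (minOver≤default (singleton v) F d)
                    (≤minOver (singleton v) F d ℕₚ.≤-refl (λ u u∈ → subst (λ u → d ≤ F u) (sym (singleton-unique v u u∈)) d≤Fv))))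
                  (ℕₚ.m≤n⇒m⊓n≡m d≤n)

-- The heap-labelled k-ary tree

module _ where
  open import Data.Nat using (_+_; _*_; _^_; _≤_; _<_)
  open import Data.Nat.Solver using (module +-*-Solver)
  open +-*-Solver using (solve; _:=_; _:+_; _:*_; con)

  order-step : ∀ k h → order k (suc h) ≡ order k h + k ^ suc h
  order-step k h = begin
    sum (List.map (k ^_) (List.upTo (suc (suc h))))
      ≡⟨ cong (sum ∘ List.map (k ^_)) (Listₚ.upTo-∷ʳ (suc h)) ⟨
    sum (List.map (k ^_) (List.upTo (suc h) ++ List.[ suc h ]))
      ≡⟨ cong sum (Listₚ.map-++ (k ^_) (List.upTo (suc h)) _) ⟩
    sum (List.map (k ^_) (List.upTo (suc h)) ++ List.[ k ^ suc h ])
      ≡⟨ sum-++ (List.map (k ^_) (List.upTo (suc h))) _ ⟩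
    order k h + (k ^ suc h + 0)
      ≡⟨ cong (order k h +_) (ℕₚ.+-identityʳ _) ⟩
    order k h + k ^ suc h ∎
    where open ≡-Reasoning

  order-suc : ∀ k h → order k (suc h) ≡ suc (k * order k h)
  order-suc k zero    = order-step k 0
  order-suc k (suc h) = begin
    order k (suc (suc h))                ≡⟨ order-step k (suc h) ⟩
    order k (suc h) + k * k ^ suc h       ≡⟨ cong (_+ k * k ^ suc h) (order-suc k h) ⟩
    suc (k * order k h) + k * k ^ suc h   ≡⟨ cong suc (ℕₚ.*-distribˡ-+ k (order k h) (k ^ suc h)) ⟨
    suc (k * (order k h + k ^ suc h))     ≡⟨ cong (λ o → suc (k * o)) (order-step k h) ⟨
    suc (k * order k (suc h))             ∎
    where open ≡-Reasoning

  order-geometric : ∀ k h → k * order (suc k) h + 1 ≡ suc k ^ suc h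
  order-geometric k zero    = solve 1 (λ k → k :* con 1 :+ con 1 := (con 1 :+ k) :* con 1) refl k
  order-geometric k (suc h) = begin
    k * order (suc k) (suc h) + 1     ≡⟨ cong (λ o → k * o + 1) (order-suc (suc k) h) ⟩
    k * suc (suc k * o) + 1           ≡⟨ solve 2 (λ k o → k :* (con 1 :+ (con 1 :+ k) :* o) :+ con 1
                                                        := (con 1 :+ k) :* (k :* o :+ con 1)) refl k o ⟩
    suc k * (k * o + 1)               ≡⟨ cong (suc k *_) (order-geometric k h) ⟩
    suc k * suc k ^ suc h             ∎
    where
    open ≡-Reasoning
    o = order (suc k) h

  ^-injective : ∀ {k} → 1 < k → ∀ {a b} → k ^ a ≡ k ^ b → a ≡ b
  ^-injective {k} 1<k {a} {b} eq with ℕₚ.<-cmp a b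
  ... | tri< a<b _ _ = ⊥-elim (ℕₚ.<-irrefl eq (ℕₚ.^-monoʳ-< k 1<k a<b))
  ... | tri≈ _ a≡b _ = a≡b
  ... | tri> _ _ b<a = ⊥-elim (ℕₚ.<-irrefl (sym eq) (ℕₚ.^-monoʳ-< k 1<k b<a))

  1+n≤2^n : ∀ n → suc n ≤ 2 ^ n
  1+n≤2^n zero    = s≤s z≤n
  1+n≤2^n (suc n) = ℕₚ.+-mono-≤ {1} {2 ^ n} (ℕₚ.m^n>0 2 n) (ℕₚ.≤-trans (1+n≤2^n n) (ℕₚ.m≤m+n (2 ^ n) 0))

  order≤2^ : ∀ k h → order k h ≤ 2 ^ (k * h)
  order≤2^ k zero    = subst (λ e → 1 ≤ 2 ^ e) (sym (ℕₚ.*-zeroʳ k)) ℕₚ.≤-refl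
  order≤2^ k (suc h) = begin
    order k (suc h)                 ≡⟨ order-suc k h ⟩
    suc (k * order k h)             ≤⟨ ℕₚ.+-monoˡ-≤ (k * order k h) (s≤s z≤n) ⟩
    suc k * order k h               ≤⟨ ℕₚ.*-mono-≤ (1+n≤2^n k) (order≤2^ k h) ⟩
    2 ^ k * 2 ^ (k * h)             ≡⟨ ℕₚ.^-distribˡ-+-* 2 k (k * h) ⟨
    2 ^ (k + k * h)                 ≡⟨ cong (2 ^_) (ℕₚ.*-suc k h) ⟨
    2 ^ (k * suc h)                 ∎
    where open ℕₚ.≤-Reasoning

  k^h≤order : ∀ k h → k ^ h ≤ order k h
  k^h≤order k zero    = ℕₚ.≤-refl
  k^h≤order k (suc h) = subst (k ^ suc h ≤_) (sym (order-step k h)) (ℕₚ.m≤n+m _ _)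

  h<order : ∀ k h → 1 ≤ k → h < order k h
  h<order k zero    _   = ℕₚ.≤-refl
  h<order k (suc h) 1≤k = begin
    suc (suc h)            ≡⟨ ℕₚ.+-comm 1 (suc h) ⟩
    suc h + 1              ≤⟨ ℕₚ.+-mono-≤ (h<order k h 1≤k) (subst (_≤ k ^ suc h) (ℕₚ.^-zeroˡ (suc h)) (ℕₚ.^-monoˡ-≤ (suc h) 1≤k)) ⟩
    order k h + k ^ suc h  ≡⟨ order-step k h ⟨
    order k (suc h)        ∎
    where open ℕₚ.≤-Reasoning

lookupℕ : ∀ {n} → Vec Bool n → ℕ → Bool
lookupℕ []      i       = false
lookupℕ (b ∷ B) zero    = b
lookupℕ (b ∷ B) (suc i) = lookupℕ B i

lookupℕ-toℕ : ∀ {n} (B : Vec Bool n) i → lookupℕ B (toℕ i) ≡ lookup B i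
lookupℕ-toℕ (b ∷ B) Fin.zero    = refl
lookupℕ-toℕ (b ∷ B) (Fin.suc i) = lookupℕ-toℕ B i

lookup-fromℕ< : ∀ {n} (B : Vec Bool n) {i} (i<n : i ℕ.< n) → lookup B (fromℕ< i<n) ≡ lookupℕ B i
lookup-fromℕ< B i<n = trans (sym (lookupℕ-toℕ B (fromℕ< i<n))) (cong (lookupℕ B) (Finₚ.toℕ-fromℕ< i<n))

lookupℕ-⊆ : ∀ {n} {B B′ : Coloring n} → B ⊆ B′ → ∀ i → lookupℕ B i ≡ true → lookupℕ B′ i ≡ true
lookupℕ-⊆ {B = b ∷ B} {b′ ∷ B′} B⊆B′ zero    = B⊆B′ Fin.zero
lookupℕ-⊆ {B = b ∷ B} {b′ ∷ B′} B⊆B′ (suc i) = lookupℕ-⊆ {B = B} {B′} (B⊆B′ ∘ Fin.suc) i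

T⇒≡true : ∀ {b} → T b → b ≡ true
T⇒≡true = Equivalence.to Boolₚ.T-≡

≡true⇒T : ∀ {b} → b ≡ true → T b
≡true⇒T = Equivalence.from Boolₚ.T-≡

module _ where
  open import Data.Nat using (_+_; _≤_; _<_)

  countℕ : (ℕ → Bool) → ℕ → ℕ
  countℕ P n = countFin {n} (P ∘ toℕ)

  countℕ-interval : ∀ n (P : ℕ → Bool) a m → (∀ i → P i ≡ true → a ≤ i × i < a + m) → countℕ P n ≤ m
  countℕ-interval zero    P a m inI = z≤n
  countℕ-interval (suc n) P zero m inI with P 0 in P0
  countℕ-interval (suc n) P zero zero    inI | true  = case proj₂ (inI 0 P0) of λ ()
  countℕ-interval (suc n) P zero (suc m) inI | true  =
    s≤s (countℕ-interval n (P ∘ suc) 0 m (λ i Pi → z≤n , ℕₚ.≤-pred (proj₂ (inI (suc i) Pi))))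
  countℕ-interval (suc n) P zero m inI | false =
    countℕ-interval n (P ∘ suc) 0 m (λ i Pi → z≤n , ℕₚ.<-trans (ℕₚ.n<1+n i) (proj₂ (inI (suc i) Pi)))
  countℕ-interval (suc n) P (suc a) m inI with P 0 in P0
  ... | true  = case proj₁ (inI 0 P0) of λ ()
  ... | false = countℕ-interval n (P ∘ suc) a m (λ i Pi → let a<i , i<a+m = inI (suc i) Pi in ℕₚ.≤-pred a<i , ℕₚ.≤-pred i<a+m)

module HeapLabelling (k-2 : ℕ) where
  open import Data.Nat using (_+_; _*_; _≤_; _<_; _/_; _≤ᵇ_)

  k : ℕ
  k = suc (suc k-2)

  /-unique : ∀ i {x} → i * k ≤ x → x < i * k + k → x / k ≡ i
  /-unique i {x} lo hi = ℕₚ.≤-antisym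
    (ℕₚ.<⇒≤pred (m<n*o⇒m/o<n {x} {suc i} {k} (subst (x <_) (ℕₚ.+-comm (i * k) k) hi)))
    (subst (_≤ x / k) (m*n/n≡m i k) (/-monoˡ-≤ k lo))

  /k<1+ : ∀ v → v / k < suc v
  /k<1+ v = s≤s (m/n≤m v k)

  isParent-/ : ∀ v → isParent k (v / k) (suc v) ≡ true
  isParent-/ v = cong₂ _∧_ (T⇒≡true (ℕₚ.≤⇒≤ᵇ (s≤s lo))) (T⇒≡true (ℕₚ.≤⇒≤ᵇ hi))
    where
    lo : k * (v / k) ≤ v
    lo = subst (_≤ v) (ℕₚ.*-comm (v / k) k) (m/n*n≤m v k)
    hi : suc v ≤ k * (v / k) + k
    hi = subst (suc v ≤_) (trans (ℕₚ.+-comm k ((v / k) * k)) (cong (_+ k) (ℕₚ.*-comm (v / k) k)))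
           (subst (λ x → suc x ≤ k + (v / k) * k) (sym (m≡m%n+[m/n]*n v k)) (ℕₚ.+-monoˡ-≤ ((v / k) * k) (m%n<n v k)))

  isParent⇒/ : ∀ {i j} → isParent k i j ≡ true → ∃ λ j′ → j ≡ suc j′ × j′ / k ≡ i
  isParent⇒/ {i} {j} ij = child (ℕₚ.≤ᵇ⇒≤ _ j (≡true⇒T (Boolₚ.∧-conicalˡ _ _ ij)))
                                (ℕₚ.≤ᵇ⇒≤ j _ (≡true⇒T (Boolₚ.∧-conicalʳ (suc (k * i) ≤ᵇ j) _ ij)))
    where
    child : ∀ {j} → suc (k * i) ≤ j → j ≤ k * i + k → ∃ λ j′ → j ≡ suc j′ × j′ / k ≡ i
    child {suc j′} (s≤s lo) hi =
      j′ , refl , /-unique i (subst (_≤ j′) (ℕₚ.*-comm k i) lo) (subst (j′ <_) (cong (_+ k) (ℕₚ.*-comm k i)) hi)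

  foldPathFuel : {A : Set} → A → (ℕ → A → A) → ℕ → ℕ → A
  foldPathFuel a s zero    v       = a
  foldPathFuel a s (suc f) zero    = a
  foldPathFuel a s (suc f) (suc v) = s (suc v) (foldPathFuel a s f (v / k))

  foldPathFuel-enough : {A : Set} (a : A) (s : ℕ → A → A) → ∀ {f f′ v} → v < f → v < f′ →
                        foldPathFuel a s f v ≡ foldPathFuel a s f′ v
  foldPathFuel-enough a s {suc f} {suc f′} {zero}  _         _          = refl
  foldPathFuel-enough a s {suc f} {suc f′} {suc v} (s≤s v<f) (s≤s v<f′) = cong (s (suc v))
    (foldPathFuel-enough a s (ℕₚ.<-≤-trans (/k<1+ v) v<f) (ℕₚ.<-≤-trans (/k<1+ v) v<f′))

  foldPath : {A : Set} → A → (ℕ → A → A) → ℕ → A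
  foldPath a s v = foldPathFuel a s (suc v) v

  foldPath-suc : {A : Set} (a : A) (s : ℕ → A → A) → ∀ v → foldPath a s (suc v) ≡ s (suc v) (foldPath a s (v / k))
  foldPath-suc a s v = cong (s (suc v)) (foldPathFuel-enough a s (/k<1+ v) (ℕₚ.n<1+n (v / k)))

module KaryTree (k-2 h : ℕ) where
  open import Data.Nat using (_+_; _*_; _∸_; _≤_; _<_; _/_)
  open HeapLabelling k-2 public

  N : ℕ
  N = order k h

  G : Graph N
  G = tree k h

  G-sym : ∀ u v → G u v ≡ G v u
  G-sym u v = Boolₚ.∨-comm (isParent k (toℕ u) (toℕ v)) (isParent k (toℕ v) (toℕ u))

  edge⇒parent : ∀ {u v} → G u v ≡ true →
    (∃ λ v′ → toℕ v ≡ suc v′ × v′ / k ≡ toℕ u) ⊎ (∃ λ u′ → toℕ u ≡ suc u′ × u′ / k ≡ toℕ v)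
  edge⇒parent {u} {v} Guv with isParent k (toℕ u) (toℕ v) in u→v
  ... | true  = inj₁ (isParent⇒/ u→v)
  ... | false = inj₂ (isParent⇒/ Guv)

  parent-edge : ∀ (w p : Fin N) {v} → toℕ w ≡ suc v → toℕ p ≡ v / k → G w p ≡ true
  parent-edge w p {v} w≡ p≡ rewrite w≡ | p≡ = trans (cong (isParent k (suc v) (v / k) ∨_) (isParent-/ v))
                                        (Boolₚ.∨-zeroʳ (isParent k (suc v) (v / k)))

  parent<N : ∀ {y} → suc y < N → y / k < N
  parent<N {y} y+1<N = ℕₚ.<-≤-trans (s≤s (ℕₚ.≤-trans (m/n≤m y k) (ℕₚ.n≤1+n y))) y+1<N

  child-parent-edge : ∀ {y} (y+1<N : suc y < N) → G (fromℕ< y+1<N) (fromℕ< (parent<N y+1<N)) ≡ true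
  child-parent-edge y+1<N = parent-edge _ _ (Finₚ.toℕ-fromℕ< y+1<N) (Finₚ.toℕ-fromℕ< (parent<N y+1<N))

  deg≤1+k : ∀ u → deg G u ≤ suc k
  deg≤1+k u = begin
    deg G u
      ≤⟨ countFin-∨ {N} (isParent k (toℕ u) ∘ toℕ) (λ j → isParent k (toℕ j) (toℕ u)) ⟩
    countℕ (isParent k (toℕ u)) N + countℕ (λ j → isParent k j (toℕ u)) N
      ≤⟨ ℕₚ.+-mono-≤ children parents ⟩
    k + 1
      ≡⟨ ℕₚ.+-comm k 1 ⟩
    suc k ∎
    where
    open ℕₚ.≤-Reasoning
    children : countℕ (isParent k (toℕ u)) N ≤ k
    children = countℕ-interval N (isParent k (toℕ u)) (suc (k * toℕ u)) k λ i ui →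
        ℕₚ.≤ᵇ⇒≤ _ _ (≡true⇒T (Boolₚ.∧-conicalˡ _ _ ui))
      , s≤s (ℕₚ.≤ᵇ⇒≤ _ _ (≡true⇒T (Boolₚ.∧-conicalʳ (suc (k * toℕ u) ℕ.≤ᵇ i) _ ui)))
    parents : countℕ (λ j → isParent k j (toℕ u)) N ≤ 1
    parents = countℕ-interval N (λ j → isParent k j (toℕ u)) ((toℕ u ∸ 1) / k) 1 λ i iu → case isParent⇒/ {i} {toℕ u} iu of λ where
      (u′ , u≡ , u′/k≡i) → subst (λ x → (x ∸ 1) / k ≤ i × i < (x ∸ 1) / k + 1) (sym u≡)
                             (ℕₚ.≤-reflexive u′/k≡i , subst (_< u′ / k + 1) u′/k≡i (ℕₚ.m<m+n (u′ / k) (s≤s z≤n)))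

-- Upper bound for the tree

module _ where
  open import Data.Nat using (_+_; _∸_; _^_)

  2^[1+e]∸1 : ∀ e → 2 ^ suc e ∸ 1 ≡ 2 ^ e + (2 ^ e ∸ 1)
  2^[1+e]∸1 e = trans (cong (_∸ 1) (cong (2 ^ e +_) (ℕₚ.+-identityʳ (2 ^ e)))) (ℕₚ.+-∸-assoc (2 ^ e) (ℕₚ.m^n>0 2 e))

module _ where
  open import Data.Rational using (_+_; _*_; _-_; -_; _≤_)
  open ℚ-Solver.+-*-Solver using (solve; _:=_; _:+_; _:*_; _:-_; :-_; con)

  fromℕ-2^[1+e]∸1 : ∀ e → fromℕ (2 ℕ.^ suc e ℕ.∸ 1) ≡ fromℕ (2 ℕ.^ e) + fromℕ (2 ℕ.^ e ℕ.∸ 1)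
  fromℕ-2^[1+e]∸1 e = trans (cong fromℕ (2^[1+e]∸1 e)) (fromℕ-+ (2 ℕ.^ e) _)

  ½*[2^[1+e]∸1]≤2^e : ∀ e → ½ * fromℕ (2 ℕ.^ suc e ℕ.∸ 1) ≤ fromℕ (2 ℕ.^ e)
  ½*[2^[1+e]∸1]≤2^e e = begin
    ½ * fromℕ (2 ℕ.^ suc e ℕ.∸ 1)   ≤⟨ ℚₚ.*-monoˡ-≤-nonNeg ½ {{ℚ.nonNegative (0≤ratio 1 2)}} (fromℕ-mono-≤ (ℕₚ.m∸n≤m (2 ℕ.^ suc e) 1)) ⟩
    ½ * fromℕ (2 ℕ.* 2 ℕ.^ e)       ≡⟨ cong (½ *_) (fromℕ-* 2 (2 ℕ.^ e)) ⟩
    ½ * (fromℕ 2 * b)               ≡⟨ solve 3 (λ h t b → h :* (t :* b) := (t :* h) :* b) refl ½ (fromℕ 2) b ⟩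
    (fromℕ 2 * ½) * b               ≡⟨ trans (cong (_* b) (fromℕ-*-1/[1+K] 1)) (ℚₚ.*-identityˡ b) ⟩
    b                               ∎
    where
    open ℚₚ.≤-Reasoning
    b = fromℕ (2 ℕ.^ e)

  halving-drift : ∀ {p a b t} → 0ℚ ≤ p → 0ℚ ≤ b → p ≤ t → ½ * a ≤ b → a + (- b) * t ≤ (1ℚ - p * ½) * a
  halving-drift {p} {a} {b} {t} 0≤p 0≤b p≤t ½a≤b = ≤-via-difference
    (ℚₚ.+-mono-≤ (*-nonNeg 0≤b (p≤q⇒0≤q-p p≤t)) (*-nonNeg 0≤p (p≤q⇒0≤q-p ½a≤b)))
    (solve 4 (λ b t p a → (con 1ℚ :- p :* con ½) :* a :- (a :+ (:- b) :* t)
                          := b :* (t :- p) :+ p :* (b :- con ½ :* a) :- con 0ℚ) refl b t p a)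

module _ where
  open import Data.Nat using (_+_; _*_; _^_; _≤_)
  open import Data.Nat.Solver using (module +-*-Solver)
  open +-*-Solver using (solve; _:=_; _:+_; _:*_; con)

  h≤⌊log₂order⌋ : ∀ k h → 2 ≤ k → h ≤ ⌊log₂ order k h ⌋
  h≤⌊log₂order⌋ k h 2≤k = subst (_≤ ⌊log₂ order k h ⌋) (⌊log₂[2^n]⌋≡n h)
    (⌊log₂⌋-mono-≤ (ℕₚ.≤-trans (ℕₚ.^-monoˡ-≤ h 2≤k) (k^h≤order k h)))

  n≤n^2 : ∀ n → n ≤ n ^ 2
  n≤n^2 zero    = z≤n
  n≤n^2 (suc n) = ℕₚ.m≤m*n (suc n) (suc n ^ 1)

  2+[k+1]h≤[k+3]⌊log₂order⌋² : ∀ k h → 2 ≤ k → 1 ≤ h → suc (k * h + suc h) ≤ (k + 3) * ⌊log₂ order k h ⌋ ^ 2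
  2+[k+1]h≤[k+3]⌊log₂order⌋² k (suc h) 2≤k _ = begin
    suc (k * suc h + suc (suc h))            ≤⟨ ℕₚ.m≤m+n _ (2 * h) ⟩
    suc (k * suc h + suc (suc h)) + 2 * h    ≡⟨ solve 2 (λ k h → (con 1 :+ (k :* (con 1 :+ h) :+ (con 2 :+ h))) :+ con 2 :* h
                                                             := (k :+ con 3) :* (con 1 :+ h)) refl k h ⟩
    (k + 3) * suc h                          ≤⟨ ℕₚ.*-monoʳ-≤ (k + 3) (ℕₚ.≤-trans (h≤⌊log₂order⌋ k (suc h) 2≤k) (n≤n^2 ℓ)) ⟩
    (k + 3) * ℓ ^ 2                          ∎
    where
    open ℕₚ.≤-Reasoning
    ℓ = ⌊log₂ order k (suc h) ⌋

module WhiteDepth (k-2 h : ℕ) where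
  open KaryTree k-2 h
  open import Data.Nat using (_+_; _*_; _≤_; _<_; _/_)

  𝟙white : Coloring N → ℕ → ℕ
  𝟙white B v = if lookupℕ B v then 0 else 1

  whiteDepth : Coloring N → ℕ → ℕ
  whiteDepth B = foldPath (𝟙white B 0) (λ v d → 𝟙white B v + d)

  whiteDepth-suc : ∀ B v → whiteDepth B (suc v) ≡ 𝟙white B (suc v) + whiteDepth B (v / k)
  whiteDepth-suc B = foldPath-suc (𝟙white B 0) (λ v d → 𝟙white B v + d)

  𝟙white≤1 : ∀ B v → 𝟙white B v ≤ 1
  𝟙white≤1 B v with lookupℕ B v
  ... | true  = z≤n
  ... | false = ℕₚ.≤-refl

  𝟙white-antimono : ∀ {B B′} → B ⊆ B′ → ∀ v → 𝟙white B′ v ≤ 𝟙white B v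
  𝟙white-antimono {B} {B′} B⊆B′ v with lookupℕ B v in Bv
  ... | true  = ℕₚ.≤-reflexive (cong (if_then 0 else 1) (lookupℕ-⊆ {B = B} {B′} B⊆B′ v Bv))
  ... | false = 𝟙white≤1 B′ v

  𝟙white-blue : ∀ B {v} → lookupℕ B v ≡ true → 𝟙white B v ≡ 0
  𝟙white-blue B Bv rewrite Bv = refl

  𝟙white-pos : ∀ B v → 1 ≤ 𝟙white B v → lookupℕ B v ≡ false
  𝟙white-pos B v 1≤ with lookupℕ B v
  ... | false = refl

  𝟙white-zero : ∀ B v → 𝟙white B v ≡ 0 → lookupℕ B v ≡ true
  𝟙white-zero B v ≡0 with lookupℕ B v
  ... | true = refl

  𝟙white≤whiteDepth : ∀ B v → 𝟙white B v ≤ whiteDepth B v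
  𝟙white≤whiteDepth B zero    = ℕₚ.≤-refl
  𝟙white≤whiteDepth B (suc v) = subst (𝟙white B (suc v) ≤_) (sym (whiteDepth-suc B v)) (ℕₚ.m≤m+n _ _)

  whiteDepth-antimono : ∀ {B B′} → B ⊆ B′ → ∀ v → whiteDepth B′ v ≤ whiteDepth B v
  whiteDepth-antimono {B} {B′} B⊆B′ = <-rec _ λ where
    zero    _  → 𝟙white-antimono {B} {B′} B⊆B′ 0
    (suc v) IH → subst₂ _≤_ (sym (whiteDepth-suc B′ v)) (sym (whiteDepth-suc B v))
                            (ℕₚ.+-mono-≤ (𝟙white-antimono {B} {B′} B⊆B′ (suc v)) (IH (/k<1+ v)))

  whiteDepth≤1+height : ∀ B h′ v → v < order k h′ → whiteDepth B v ≤ suc h′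
  whiteDepth≤1+height B h′       zero    _ = ℕₚ.≤-trans (𝟙white≤1 B 0) (s≤s z≤n)
  whiteDepth≤1+height B zero     (suc v) (s≤s ())
  whiteDepth≤1+height B (suc h′) (suc v) v<order = subst (_≤ suc (suc h′)) (sym (whiteDepth-suc B v))
    (ℕₚ.+-mono-≤ (𝟙white≤1 B (suc v)) (whiteDepth≤1+height B h′ (v / k) parent<order))
    where
    parent<order : v / k < order k h′
    parent<order = m<n*o⇒m/o<n {v} {order k h′} {k}
      (subst (v <_) (ℕₚ.*-comm k (order k h′)) (ℕₚ.≤-pred (subst (suc v <_) (order-suc k h′) v<order)))

  record Frontier (B : Coloring N) (v : ℕ) : Set where
    field
      w-1         : ℕ
      w≤v         : suc w-1 ≤ v
      w-white     : lookupℕ B (suc w-1) ≡ false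
      parent-blue : lookupℕ B (w-1 / k) ≡ true
      shortens    : ∀ {B′} → B ⊆ B′ → lookupℕ B′ (suc w-1) ≡ true → whiteDepth B′ v < whiteDepth B v

  frontier : ∀ B → lookupℕ B 0 ≡ true → ∀ v → 1 ≤ whiteDepth B v → Frontier B v
  frontier B root-blue = <-rec _ go
    where
    go : ∀ v → (∀ {u} → u < v → 1 ≤ whiteDepth B u → Frontier B u) → 1 ≤ whiteDepth B v → Frontier B v
    go zero    IH 1≤d = case subst (1 ≤_) (𝟙white-blue B root-blue) 1≤d of λ ()
    go (suc v) IH 1≤d with whiteDepth B (v / k) in parent-depth
    ... | suc _ = record
      { w-1 = F.w-1 ; w≤v = ℕₚ.≤-trans F.w≤v (ℕₚ.≤-trans (m/n≤m v k) (ℕₚ.n≤1+n v))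
      ; w-white = F.w-white ; parent-blue = F.parent-blue
      ; shortens = λ {B′} B⊆B′ B′w → subst₂ _<_ (sym (whiteDepth-suc B′ v)) (sym (whiteDepth-suc B v))
                                  (ℕₚ.+-mono-≤-< (𝟙white-antimono {B} {B′} B⊆B′ (suc v)) (F.shortens {B′} B⊆B′ B′w)) }
      where
      module F = Frontier (IH (/k<1+ v) (subst (1 ≤_) (sym parent-depth) (s≤s z≤n)))
    ... | zero = record
      { w-1 = v ; w≤v = ℕₚ.≤-refl
      ; w-white = 𝟙white-pos B (suc v) 1≤𝟙white
      ; parent-blue = 𝟙white-zero B (v / k) (ℕₚ.n≤0⇒n≡0 (subst (𝟙white B (v / k) ≤_) parent-depth (𝟙white≤whiteDepth B (v / k))))
      ; shortens = λ {B′} B⊆B′ B′w → begin-strict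
          whiteDepth B′ (suc v)                   ≡⟨ whiteDepth-suc B′ v ⟩
          𝟙white B′ (suc v) + whiteDepth B′ (v / k) ≡⟨ cong (_+ whiteDepth B′ (v / k)) (𝟙white-blue B′ B′w) ⟩
          whiteDepth B′ (v / k)                   ≤⟨ subst (whiteDepth B′ (v / k) ≤_) parent-depth (whiteDepth-antimono {B} {B′} B⊆B′ (v / k)) ⟩
          0                                       <⟨ 1≤d ⟩
          whiteDepth B (suc v)                    ∎ }
      where
      open ℕₚ.≤-Reasoning
      1≤𝟙white : 1 ≤ 𝟙white B (suc v)
      1≤𝟙white = subst (1 ≤_) (trans (whiteDepth-suc B v) (trans (cong (𝟙white B (suc v) +_) parent-depth) (ℕₚ.+-identityʳ _))) 1≤d

module TreeUpperBound (k-2 h : ℕ) where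
  open KaryTree k-2 h
  open WhiteDepth k-2 h
  open RoundChain G G-sym
  open MultiplicativeDrift G G-sym
  open import Data.Rational using (_+_; _*_; _-_; -_; _≤_)
  open ℚ-Solver.+-*-Solver using (solve; _:=_; _:+_; _:*_; _:-_; :-_; con)

  p : ℚ
  p = ratio 1 (suc k)

  ρ : ℚ
  ρ = p * ½

  0≤ρ : 0ℚ ≤ ρ
  0≤ρ = *-nonNeg (0≤ratio 1 (suc k)) (0≤ratio 1 2)

  root : Fin N
  root = Fin.zero

  RootBlue : Coloring N → Set
  RootBlue B = lookup B root ≡ true

  X : Coloring N → Fin N → ℕ
  X B v = 2 ℕ.^ whiteDepth B (toℕ v) ℕ.∸ 1

  X-drift-frontier : ∀ B v {e} → whiteDepth B (toℕ v) ≡ suc e → Frontier B (toℕ v) →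
                     𝔼 B (λ B′ → fromℕ (X B′ v)) ≤ (1ℚ - ρ) * fromℕ (X B v)
  X-drift-frontier B v {e} depth≡ F = begin
    𝔼 B (λ B′ → fromℕ (X B′ v))               ≤⟨ 𝔼-mono B X≤ ⟩
    𝔼 B (λ B′ → a + (- b) * 𝟙 (lookup B′ w))   ≡⟨ 𝔼-affine-𝟙 B Bw≡false a (- b) ⟩
    a + (- b) * turnProb G B w                ≤⟨ halving-drift (0≤ratio 1 (suc k)) (0≤fromℕ (2 ℕ.^ e)) p≤turnProb (½*[2^[1+e]∸1]≤2^e e) ⟩
    (1ℚ - ρ) * a                              ≡⟨ cong (λ d → (1ℚ - ρ) * fromℕ (2 ℕ.^ d ℕ.∸ 1)) depth≡ ⟨
    (1ℚ - ρ) * fromℕ (X B v)                 ∎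
    where
    open ℚₚ.≤-Reasoning
    module F = Frontier F
    a b : ℚ
    a = fromℕ (2 ℕ.^ suc e ℕ.∸ 1)
    b = fromℕ (2 ℕ.^ e)
    w<N : suc F.w-1 ℕ.< N
    w<N = ℕₚ.<-≤-trans (s≤s F.w≤v) (Finₚ.toℕ<n v)
    w parent : Fin N
    w      = fromℕ< w<N
    parent = fromℕ< (parent<N w<N)
    Bw≡false : lookup B w ≡ false
    Bw≡false = trans (lookup-fromℕ< B w<N) F.w-white
    p≤turnProb : p ≤ turnProb G B w
    p≤turnProb = 1/[1+K]≤turnProb B k Bw≡false (child-parent-edge w<N)
      (trans (lookup-fromℕ< B (parent<N w<N)) F.parent-blue) (deg≤1+k parent)
    X≤ : ∀ B′ → B ⊆ B′ → fromℕ (X B′ v) ≤ a + (- b) * 𝟙 (lookup B′ w)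
    X≤ B′ B⊆B′ with lookup B′ w in B′w
    ... | true  = begin
      fromℕ (X B′ v)              ≤⟨ fromℕ-mono-≤ (ℕₚ.∸-monoˡ-≤ 1 (ℕₚ.^-monoʳ-≤ 2 depth′≤e)) ⟩
      fromℕ (2 ℕ.^ e ℕ.∸ 1)       ≡⟨ solve 2 (λ b c → c := (b :+ c) :+ (:- b) :* con 1ℚ) refl b (fromℕ (2 ℕ.^ e ℕ.∸ 1)) ⟩
      (b + fromℕ (2 ℕ.^ e ℕ.∸ 1)) + (- b) * 1ℚ ≡⟨ cong (λ x → x + (- b) * 1ℚ) (fromℕ-2^[1+e]∸1 e) ⟨
      a + (- b) * 1ℚ              ∎
      where
      depth′≤e : whiteDepth B′ (toℕ v) ℕ.≤ e
      depth′≤e = ℕₚ.≤-pred (subst (suc (whiteDepth B′ (toℕ v)) ℕ.≤_) depth≡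
                   (F.shortens {B′} B⊆B′ (trans (sym (lookup-fromℕ< B′ w<N)) B′w)))
    ... | false = begin
      fromℕ (X B′ v)              ≤⟨ fromℕ-mono-≤ (ℕₚ.∸-monoˡ-≤ 1 (ℕₚ.^-monoʳ-≤ 2 (whiteDepth-antimono {B} {B′} B⊆B′ (toℕ v)))) ⟩
      fromℕ (X B v)               ≡⟨ cong (λ d → fromℕ (2 ℕ.^ d ℕ.∸ 1)) depth≡ ⟩
      a                           ≡⟨ solve 2 (λ a b → a := a :+ (:- b) :* con 0ℚ) refl a b ⟩
      a + (- b) * 0ℚ              ∎

  X-drift : ∀ B → RootBlue B → ∀ v → 𝔼 B (λ B′ → fromℕ (X B′ v)) ≤ (1ℚ - ρ) * fromℕ (X B v)
  X-drift B root-blue v = by-depth (whiteDepth B (toℕ v)) refl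
    where
    open ℚₚ.≤-Reasoning
    by-depth : ∀ d → whiteDepth B (toℕ v) ≡ d → 𝔼 B (λ B′ → fromℕ (X B′ v)) ≤ (1ℚ - ρ) * fromℕ (X B v)
    by-depth (suc e) depth≡ = X-drift-frontier B v depth≡
      (frontier B (trans (lookupℕ-toℕ B root) root-blue) (toℕ v) (subst (1 ℕ.≤_) (sym depth≡) (s≤s z≤n)))
    by-depth zero    depth≡ = begin
      𝔼 B (λ B′ → fromℕ (X B′ v))   ≤⟨ 𝔼-mono B X≤0 ⟩
      𝔼 B (λ _ → 0ℚ)                 ≡⟨ 𝔼-const B 0ℚ ⟩
      0ℚ                              ≡⟨ ℚₚ.*-zeroʳ (1ℚ - ρ) ⟨
      (1ℚ - ρ) * 0ℚ                   ≡⟨ cong (λ d → (1ℚ - ρ) * fromℕ (2 ℕ.^ d ℕ.∸ 1)) depth≡ ⟨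
      (1ℚ - ρ) * fromℕ (X B v)       ∎
      where
      X≤0 : ∀ B′ → B ⊆ B′ → fromℕ (X B′ v) ≤ 0ℚ
      X≤0 B′ B⊆B′ = fromℕ-mono-≤ (ℕₚ.≤-reflexive (cong (λ d → 2 ℕ.^ d ℕ.∸ 1)
                      (ℕₚ.n≤0⇒n≡0 (subst (whiteDepth B′ (toℕ v) ℕ.≤_) depth≡ (whiteDepth-antimono {B} {B′} B⊆B′ (toℕ v))))))

  Φ : Coloring N → ℕ
  Φ B = sumℕ (X B)

  Φ-drift : ∀ B → RootBlue B → 𝔼 B (fromℕ ∘ Φ) ≤ (1ℚ - ρ) * fromℕ (Φ B)
  Φ-drift B root-blue = begin
    𝔼 B (fromℕ ∘ Φ)                                 ≡⟨ 𝔼-cong B (λ B′ → sym (sumQ-fromℕ (X B′))) ⟩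
    𝔼 B (λ B′ → sumQ (λ v → fromℕ (X B′ v)))         ≡⟨ 𝔼-sumQ B (λ v B′ → fromℕ (X B′ v)) ⟩
    sumQ (λ v → 𝔼 B (λ B′ → fromℕ (X B′ v)))         ≤⟨ sumQ-mono (X-drift B root-blue) ⟩
    sumQ (λ v → (1ℚ - ρ) * fromℕ (X B v))            ≡⟨ sumQ-*ˡ (1ℚ - ρ) (fromℕ ∘ X B) ⟩
    (1ℚ - ρ) * sumQ (fromℕ ∘ X B)                    ≡⟨ cong ((1ℚ - ρ) *_) (sumQ-fromℕ (X B)) ⟩
    (1ℚ - ρ) * fromℕ (Φ B)                           ∎
    where open ℚₚ.≤-Reasoning

  1≤Φ : ∀ B → allBlue B ≡ false → 1 ℕ.≤ Φ B
  1≤Φ B full = let i , Bi = allBlue≡false⇒white B full in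
    ℕₚ.≤-trans (ℕₚ.∸-monoˡ-≤ 1 (ℕₚ.^-monoʳ-≤ 2 (1≤depth i Bi))) (term≤sumℕ (X B) i)
    where
    1≤depth : ∀ i → lookup B i ≡ false → 1 ℕ.≤ whiteDepth B (toℕ i)
    1≤depth i Bi = ℕₚ.≤-trans (ℕₚ.≤-reflexive (cong (if_then 0 else 1) (sym (trans (lookupℕ-toℕ B i) Bi))))
                              (𝟙white≤whiteDepth B (toℕ i))

  logBound : ℕ
  logBound = k ℕ.* h ℕ.+ suc h

  Φ≤2^logBound : ∀ B → Φ B ℕ.≤ 2 ℕ.^ logBound
  Φ≤2^logBound B = begin
    Φ B                           ≤⟨ sumℕ≤ (X B) (λ v → ℕₚ.≤-trans (ℕₚ.m∸n≤m _ 1)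
                                        (ℕₚ.^-monoʳ-≤ 2 (whiteDepth≤1+height B h (toℕ v) (Finₚ.toℕ<n v)))) ⟩
    N ℕ.* 2 ℕ.^ suc h             ≤⟨ ℕₚ.*-monoˡ-≤ (2 ℕ.^ suc h) (order≤2^ k h) ⟩
    2 ℕ.^ (k ℕ.* h) ℕ.* 2 ℕ.^ suc h ≡⟨ ℕₚ.^-distribˡ-+-* 2 (k ℕ.* h) (suc h) ⟨
    2 ℕ.^ logBound                       ∎
    where open ℕₚ.≤-Reasoning

  c : ℕ
  c = 4 ℕ.* suc k

  c*ρ/2≡1 : fromℕ c * (ρ * ½) ≡ 1ℚ
  c*ρ/2≡1 = begin
    fromℕ (2 ℕ.* 2 ℕ.* suc k) * ((p * ½) * ½)
      ≡⟨ cong (_* ((p * ½) * ½)) (trans (fromℕ-* (2 ℕ.* 2) (suc k)) (cong (_* fromℕ (suc k)) (fromℕ-* 2 2))) ⟩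
    (fromℕ 2 * fromℕ 2 * fromℕ (suc k)) * ((p * ½) * ½)
      ≡⟨ solve 4 (λ t s p h → (t :* t :* s) :* ((p :* h) :* h) := (s :* p) :* (t :* h) :* (t :* h)) refl (fromℕ 2) (fromℕ (suc k)) p ½ ⟩
    (fromℕ (suc k) * p) * (fromℕ 2 * ½) * (fromℕ 2 * ½)
      ≡⟨ cong₂ (λ x y → x * y * y) (fromℕ-*-1/[1+K] k) (fromℕ-*-1/[1+K] 1) ⟩
    1ℚ ∎
    where open ≡-Reasoning

  ept≤logPotentialBound : ept G ≤ fromℕ c * fromℕ (suc logBound)
  ept≤logPotentialBound = ℚₚ.≤-trans (ept≤eptFrom-zero G)
    (multiplicativeDrift RootBlue (λ Broot B⊆B′ → B⊆B′ root Broot) Φ logBound ρ c 0≤ρ (ℚₚ.≤-reflexive (sym c*ρ/2≡1))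
                         1≤Φ Φ≤2^logBound Φ-drift N (singleton root) (singleton-self root))

  ept≤c[k+3]⌊log₂N⌋² : 1 ℕ.≤ h → ept G ≤ fromℕ (c ℕ.* (k ℕ.+ 3) ℕ.* ⌊log₂ N ⌋ ℕ.^ 2)
  ept≤c[k+3]⌊log₂N⌋² 1≤h = begin
    ept G                                      ≤⟨ ept≤logPotentialBound ⟩
    fromℕ c * fromℕ (suc logBound)             ≡⟨ fromℕ-* c (suc logBound) ⟨
    fromℕ (c ℕ.* suc logBound)                 ≤⟨ fromℕ-mono-≤ (ℕₚ.*-monoʳ-≤ c (2+[k+1]h≤[k+3]⌊log₂order⌋² k h (s≤s (s≤s z≤n)) 1≤h)) ⟩
    fromℕ (c ℕ.* ((k ℕ.+ 3) ℕ.* ⌊log₂ N ⌋ ℕ.^ 2)) ≡⟨ cong fromℕ (ℕₚ.*-assoc c (k ℕ.+ 3) (⌊log₂ N ⌋ ℕ.^ 2)) ⟨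
    fromℕ (c ℕ.* (k ℕ.+ 3) ℕ.* ⌊log₂ N ⌋ ℕ.^ 2)  ∎
    where open ℚₚ.≤-Reasoning

-- Lower bound for the tree

module TreeLowerBound (k-2 h : ℕ) where
  open KaryTree k-2 h
  open RoundChain G G-sym
  open LipschitzLowerBound G G-sym
  open import Data.Nat using (_+_; _*_; _∸_; _≤_; _<_; _/_; _≡ᵇ_)
  open import Data.Rational using () renaming (_≤_ to _≤ℚ_)

  ColourChange : Coloring N → Bool → ℕ → Set
  ColourChange B β x = ∃ λ y → suc y ≤ x × lookupℕ B (suc y) ≡ β × lookupℕ B (y / k) ≡ not β

  colourChange : ∀ B β → lookupℕ B 0 ≡ not β → ∀ x → lookupℕ B x ≡ β → ColourChange B β x
  colourChange B β root≡ = <-rec _ go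
    where
    go : ∀ x → (∀ {y} → y < x → lookupℕ B y ≡ β → ColourChange B β y) → lookupℕ B x ≡ β → ColourChange B β x
    go zero    IH Bx = ⊥-elim (Boolₚ.not-¬ refl (trans (sym Bx) root≡))
    go (suc x) IH Bx with lookupℕ B (x / k) Boolₚ.≟ β
    ... | no  parent≢β = x , ℕₚ.≤-refl , Bx , Boolₚ.¬-not parent≢β
    ... | yes parent≡β = let y , y<x/k , By , Bparent = IH (/k<1+ x) parent≡β in
      y , ℕₚ.≤-trans y<x/k (ℕₚ.≤-trans (m/n≤m x k) (ℕₚ.n≤1+n x)) , By , Bparent

  boundaryEdge : ∀ B → Nonempty B → allBlue B ≡ false → BoundaryEdge B
  boundaryEdge B (i , Bi) full with lookupℕ B 0 in root≡
  ... | true  = let j , Bj = allBlue≡false⇒white B full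
                    y , y<j , By , Bparent = colourChange B false root≡ (toℕ j) (trans (lookupℕ-toℕ B j) Bj)
                    y+1<N = ℕₚ.<-≤-trans (s≤s y<j) (Finₚ.toℕ<n j)
                in  fromℕ< y+1<N , fromℕ< (parent<N y+1<N)
                  , trans (lookup-fromℕ< B y+1<N) By , trans (lookup-fromℕ< B (parent<N y+1<N)) Bparent
                  , child-parent-edge y+1<N
  ... | false = let y , y<i , By , Bparent = colourChange B true root≡ (toℕ i) (trans (lookupℕ-toℕ B i) Bi)
                    y+1<N = ℕₚ.<-≤-trans (s≤s y<i) (Finₚ.toℕ<n i)
                in  fromℕ< (parent<N y+1<N) , fromℕ< y+1<N
                  , trans (lookup-fromℕ< B (parent<N y+1<N)) Bparent , trans (lookup-fromℕ< B y+1<N) By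
                  , trans (G-sym (fromℕ< (parent<N y+1<N)) (fromℕ< y+1<N)) (child-parent-edge y+1<N)

  -- depthBranch v is the depth of v together with the child of the root above v (0 for the root).
  step : ℕ → ℕ × ℕ → ℕ × ℕ
  step v (d , b) = suc d , (if d ≡ᵇ 0 then v else b)

  depthBranch : ℕ → ℕ × ℕ
  depthBranch = foldPath (0 , 0) step

  branchDistance : ℕ → ℕ × ℕ → ℕ
  branchDistance t (d , b) = if b ≡ᵇ t then h ∸ d else d + h

  F : ℕ → Fin N → ℕ
  F t v = branchDistance t (depthBranch (toℕ v))

  WithinOne : ℕ → ℕ → Set
  WithinOne a b = a ≤ suc b × b ≤ suc a

  withinOne-suc : ∀ a → WithinOne a (suc a)
  withinOne-suc a = ℕₚ.m≤n⇒m≤1+n (ℕₚ.n≤1+n a) , ℕₚ.≤-refl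

  withinOne-∸ : ∀ a d → WithinOne (a ∸ d) (a ∸ suc d)
  withinOne-∸ a d = subst (λ x → a ∸ d ≤ suc x) (trans (ℕₚ.∸-+-assoc a d 1) (cong (a ∸_) (ℕₚ.+-comm d 1))) (ℕₚ.m≤n+m∸n (a ∸ d) 1)
                  , ℕₚ.≤-trans (ℕₚ.∸-monoʳ-≤ a (ℕₚ.n≤1+n d)) (ℕₚ.n≤1+n _)

  branchDistance-step : ∀ t v db → WithinOne (branchDistance t db) (branchDistance t (step v db))
  branchDistance-step t v (zero , b) with b ≡ᵇ t | v ≡ᵇ t
  ... | true  | true  = withinOne-∸ h 0
  ... | true  | false = withinOne-suc h
  ... | false | true  = withinOne-∸ h 0
  ... | false | false = withinOne-suc h
  branchDistance-step t v (suc d , b) with b ≡ᵇ t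
  ... | true  = withinOne-∸ h (suc d)
  ... | false = withinOne-suc (suc d + h)

  depthBranch-child : ∀ {c p} → c ≡ suc p → ∀ {u} → p / k ≡ u → depthBranch c ≡ step c (depthBranch u)
  depthBranch-child {p = p} refl refl = foldPath-suc (0 , 0) step p

  F-lipschitz : ∀ t → 1-Lipschitz (F t)
  F-lipschitz t u v Guv with edge⇒parent {u} {v} Guv
  ... | inj₁ (v′ , v≡ , v′/k≡u) =
    subst (λ x → F t u ≤ suc (branchDistance t x)) (sym (depthBranch-child v≡ v′/k≡u)) (proj₁ (branchDistance-step t _ _))
  ... | inj₂ (u′ , u≡ , u′/k≡v) =
    subst (λ x → branchDistance t x ≤ suc (F t v)) (sym (depthBranch-child u≡ u′/k≡v)) (proj₂ (branchDistance-step t _ _))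

  -- The vertex at depth j reached from the root by always taking the t-th child.
  descend : ℕ → ℕ → ℕ
  descend t-1 zero    = 0
  descend t-1 (suc j) = suc (k * descend t-1 j + t-1)

  depthBranch-descend : ∀ {t-1} → t-1 < k → ∀ j → depthBranch (descend t-1 (suc j)) ≡ (suc j , suc t-1)
  depthBranch-descend {t-1} t-1<k j = trans (depthBranch-child refl (parent≡ {j})) (lemma j)
    where
    parent≡ : ∀ {j} → (k * descend t-1 j + t-1) / k ≡ descend t-1 j
    parent≡ {j} = /-unique d (subst (_≤ k * d + t-1) (ℕₚ.*-comm k d) (ℕₚ.m≤m+n (k * d) t-1))
                             (subst (λ x → k * d + t-1 < x + k) (ℕₚ.*-comm k d) (ℕₚ.+-monoʳ-< (k * d) t-1<k))
      where d = descend t-1 j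
    lemma : ∀ j → step (descend t-1 (suc j)) (depthBranch (descend t-1 j)) ≡ (suc j , suc t-1)
    lemma zero    = cong (λ x → 1 , suc (x + t-1)) (ℕₚ.*-zeroʳ k)
    lemma (suc j) = cong (step (descend t-1 (suc (suc j)))) (trans (depthBranch-child refl (parent≡ {j})) (lemma j))

  descend<order : ∀ {t-1} → t-1 < k → ∀ j → descend t-1 j < order k j
  descend<order t-1<k zero    = s≤s z≤n
  descend<order {t-1} t-1<k (suc j) = subst (descend t-1 (suc j) <_) (sym (order-suc k j)) (s≤s (begin-strict
    k * d + t-1     <⟨ ℕₚ.+-monoʳ-< (k * d) t-1<k ⟩
    k * d + k       ≡⟨ trans (ℕₚ.+-comm (k * d) k) (sym (ℕₚ.*-suc k d)) ⟩
    k * suc d       ≤⟨ ℕₚ.*-monoʳ-≤ k (descend<order t-1<k j) ⟩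
    k * order k j   ∎))
    where
    open ℕₚ.≤-Reasoning
    d = descend t-1 j

  branchDistance-descend : ∀ {t-1} → t-1 < k → ∀ j → branchDistance (suc t-1) (depthBranch (descend t-1 j)) ≡ h ∸ j
  branchDistance-descend t-1<k zero = refl
  branchDistance-descend {t-1} t-1<k (suc j) =
    trans (cong (branchDistance (suc t-1)) (depthBranch-descend t-1<k j))
          (cong (if_then h ∸ suc j else suc j + h) (T⇒≡true (ℕₚ.≡⇒≡ᵇ t-1 t-1 refl)))

  target : ∀ {t-1} → t-1 < k → Fin N
  target t-1<k = fromℕ< (descend<order t-1<k h)

  F-descend≡0 : ∀ {t-1} (t-1<k : t-1 < k) → F (suc t-1) (target t-1<k) ≡ 0
  F-descend≡0 {t-1} t-1<k rewrite Finₚ.toℕ-fromℕ< (descend<order t-1<k h) =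
    trans (branchDistance-descend t-1<k h) (ℕₚ.n∸n≡0 h)

  h≤F : ∀ v → h ≤ F 1 v ⊎ h ≤ F k v
  h≤F v with depthBranch (toℕ v)
  ... | d , b with b ≡ᵇ 1 in b≡1
  ...   | false = inj₁ (ℕₚ.m≤n+m h d)
  ...   | true rewrite ℕₚ.≡ᵇ⇒≡ b 1 (≡true⇒T b≡1) = inj₂ (ℕₚ.m≤n+m h d)

  h≤N : h ≤ N
  h≤N = ℕₚ.<⇒≤ (h<order k h (s≤s z≤n))

  h≤eptFrom : ∀ v → fromℕ h ≤ℚ eptFrom G (singleton v)
  h≤eptFrom v with h≤F v
  ... | inj₁ h≤F₁ = lipschitz≤eptFrom boundaryEdge (F 1) (F-lipschitz 1) (target (s≤s z≤n)) (F-descend≡0 (s≤s z≤n)) v h≤F₁ h≤N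
  ... | inj₂ h≤Fk = lipschitz≤eptFrom boundaryEdge (F k) (F-lipschitz k) (target ℕₚ.≤-refl) (F-descend≡0 ℕₚ.≤-refl) v h≤Fk h≤N

  h≤ept : fromℕ h ≤ℚ ept G
  h≤ept = ≤ept G h≤eptFrom

open import Data.Nat using (_^_; _≤_; _∸_)
open import Data.Integer using (+_)
open import Data.Rational using (_-_)

proposition2p15 : (k : ℕ) → 2 ≤ k →
    ((h m : ℕ) → k ^ m ≡ (k ∸ 1) Data.Nat.* order k h Data.Nat.+ 1 →
    (+ m ℚ./ 1) - 1ℚ ℚ.≤ ept (tree k h))
    × ∃ λ (C : ℕ) → ∃ λ (h₀ : ℕ) → (h : ℕ) → h₀ ≤ h →
    ept (tree k h) ℚ.≤ (+ (C Data.Nat.* ⌊log₂ order k h ⌋ ^ 2)) ℚ./ 1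
proposition2p15 k@(suc (suc k-2)) 2≤k@(s≤s (s≤s z≤n)) = lower , 4 ℕ.* suc k ℕ.* (k ℕ.+ 3) , 1 , upper
  where
  lower : ∀ h m → k ℕ.^ m ≡ (k ℕ.∸ 1) ℕ.* order k h ℕ.+ 1 → fromℕ m - 1ℚ ℚ.≤ ept (tree k h)
  lower h m k^m≡ with ^-injective 2≤k {m} {suc h} (trans k^m≡ (order-geometric (suc k-2) h))
  ... | refl = subst (ℚ._≤ ept (tree k h)) (sym (fromℕ[1+n]-1 h)) (TreeLowerBound.h≤ept k-2 h)
  upper : ∀ h → 1 ℕ.≤ h → ept (tree k h) ℚ.≤ fromℕ (4 ℕ.* suc k ℕ.* (k ℕ.+ 3) ℕ.* ⌊log₂ order k h ⌋ ℕ.^ 2)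
  upper h = TreeUpperBound.ept≤c[k+3]⌊log₂N⌋² k-2 h
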